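{- Let $n,k$ be integers with $k\le n$ and $n\ne0$. Then \[\widehat P_{n-k,k}\Big(\tfrac{X_1}{1},\ldots,\tfrac{X_{n-k+1}}{n-k+1}\Big)=\frac kn\,\widehat P_{n-k,-n}\Big(\tfrac{A_{1,1}}{1},\ldots,\tfrac{A_{n-k+1,1}}{n-k+1}\Big).\]
   Context: $\mathbb{K}$ is a field of characteristic zero. Partial Bell polynomials: $B_{0,0}=1$, $B_{m,0}=0$ ($m\ge1$), $B_{m,j}=0$ ($j>m$), and for $1\le j\le m$, $B_{m,j}=\sum\frac{m!}{\prod_ir_i!(i!)^{r_i}}\prod_iX_i^{r_i}$ over non-negative integers with $\sum r_i=j$, $\sum ir_i=m$. $A_{m,j}\in\mathbb{K}[X_1^{ -1},X_1,X_2,\ldots]$ is the unique lower triangular family with $A_{0,0}=1$, $A_{m,0}=0$ ($m\ge1$), $\sum_{i=j}^mA_{m,i}B_{i,j}=\delta_{mj}$; in particular $A_{m,1}(c_1,\ldots,c_m)$ is the $m$-th Taylor coefficient of the compositional inverse of $\sum_{i\ge1}c_ix^i/i!$ when $c_1\ne0$. Potential polynomials: $\widehat P_{m,r}:=\sum_{j=0}^mr(r-1)\cdots(r-j+1)X_0^{r-j}B_{m,j}$ for $m\ge0$, $r\in\mathbb{Z}$; $\widehat P_{m,r}(Y_0,\ldots,Y_m)$ means replacing $X_i$ by $Y_i$. -}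

module Defs where

open import Level using (_⊔_)
open import Algebra.Bundles using (CommutativeRing)
open import Data.Nat as ℕ using (ℕ; zero; suc; _≡ᵇ_; _<_; _≤_)
open import Data.Nat using (_!)
open import Data.Integer as ℤ using (ℤ; +_; -[1+_])
open import Data.List using (List; []; _∷_; map; concatMap; foldr; upTo)
open import Data.Bool using (Bool; true; false; if_then_else_; _∧_)
open import Relation.Nullary using (¬_)

module RingOps {c ℓ} (R : CommutativeRing c ℓ) where
  open CommutativeRing R

  fromℕ : ℕ → Carrier
  fromℕ zero    = 0#
  fromℕ (suc n) = 1# + fromℕ n

  fromℤ : ℤ → Carrier
  fromℤ (+ n)     = fromℕ n
  fromℤ -[1+ n ]  = - fromℕ (suc n)

  _^_ : Carrier → ℕ → Carrier
  x ^ zero  = 1#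
  x ^ suc n = x * (x ^ n)

  Σl : List Carrier → Carrier
  Σl = foldr _+_ 0#

  sumRange : ℕ → ℕ → (ℕ → Carrier) → Carrier
  sumRange a zero    f = 0#
  sumRange a (suc l) f = f a + sumRange (suc a) l f

  -- Σ_{i=a}^{b} f i  (empty if b < a)
  sumFromTo : ℕ → ℕ → (ℕ → Carrier) → Carrier
  sumFromTo a b f = sumRange a (suc b ℕ.∸ a) f

record CharZeroField c ℓ : Set (Level.suc (c ⊔ ℓ)) where
  field
    commRing : CommutativeRing c ℓ
  open CommutativeRing commRing public
  open RingOps commRing public
  field
    _⁻¹        : Carrier → Carrier
    inverseʳ   : ∀ x → ¬ (x ≈ 0#) → x * (x ⁻¹) ≈ 1#
    1≉0        : ¬ (1# ≈ 0#)
    charZero   : ∀ n → ¬ (fromℕ (suc n) ≈ 0#)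

vecs : ℕ → ℕ → List (List ℕ)
vecs zero    b = [] ∷ []
vecs (suc l) b = concatMap (λ v → map (λ e → e ∷ v) (upTo (suc b))) (vecs l b)

sumℕ : List ℕ → ℕ
sumℕ []       = 0
sumℕ (r ∷ rs) = r ℕ.+ sumℕ rs

weight : ℕ → List ℕ → ℕ
weight i []       = 0
weight i (r ∷ rs) = i ℕ.* r ℕ.+ weight (suc i) rs

denom : ℕ → List ℕ → ℕ
denom i []       = 1
denom i (r ∷ rs) = (r !) ℕ.* ((i !) ℕ.^ r) ℕ.* denom (suc i) rs

module _ {c ℓ} (K : CharZeroField c ℓ) where
  open CharZeroField K

  monomial : (ℕ → Carrier) → ℕ → List ℕ → Carrier
  monomial X i []       = 1#
  monomial X i (r ∷ rs) = (X i ^ r) * monomial X (suc i) rs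

  -- explicit formula for 1 ≤ j ≤ m: sum over (r_1,…,r_m) with
  -- Σ r_i = j and Σ i r_i = m (necessarily every r_i ≤ m)
  bellSum : ℕ → ℕ → (ℕ → Carrier) → Carrier
  bellSum m j X = Σl (map term (vecs m m))
    where
    term : List ℕ → Carrier
    term r = if (sumℕ r ≡ᵇ j) ∧ (weight 1 r ≡ᵇ m)
             then (fromℕ (m !) * (fromℕ (denom 1 r) ⁻¹)) * monomial X 1 r
             else 0#

  -- partial Bell polynomial B_{m,j} evaluated at X_i := X i (i ≥ 1)
  B : ℕ → ℕ → (ℕ → Carrier) → Carrier
  B zero    zero    X = 1#
  B (suc m) zero    X = 0#
  B zero    (suc j) X = 0#
  B (suc m) (suc j) X =
    if suc m ℕ.<ᵇ suc j then 0# else bellSum (suc m) (suc j) X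

  δ : ℕ → ℕ → Carrier
  δ m j = if m ≡ᵇ j then 1# else 0#

  record IsBellInverse (X : ℕ → Carrier) (A : ℕ → ℕ → Carrier) : Set (c ⊔ ℓ) where
    field
      A00      : A 0 0 ≈ 1#
      Am0      : ∀ m → A (suc m) 0 ≈ 0#
      lowerTri : ∀ m j → m < j → A m j ≈ 0#
      inverse  : ∀ m j → j ≤ m →
                 sumFromTo j m (λ i → A m i * B i j X) ≈ δ m j

  _^ℤ_ : Carrier → ℤ → Carrier
  x ^ℤ (+ n)    = x ^ n
  x ^ℤ -[1+ n ] = (x ⁻¹) ^ suc n

  falling : ℤ → ℕ → ℤ
  falling r zero    = + 1
  falling r (suc j) = falling r j ℤ.* (r ℤ.- + j)

  -- potential polynomial P̂_{m,r}(Y_0,…,Y_m), with Y i the value of Y_i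
  Phat : ℕ → ℤ → (ℕ → Carrier) → Carrier
  Phat m r Y = sumFromTo 0 m
    (λ j → (fromℤ (falling r j) * (Y 0 ^ℤ (r ℤ.- + j))) * B m j Y)

-- Work with formal power series over K.  If a(x) = Σ_{i≥1} X_i xⁱ/i! then
-- B_{m,j}(X) = (m!/j!)·[xᵐ] a(x)ʲ, so P̂_{m,r}(Y) = m!·[xᵐ] F(x)ʳ where
-- F(x) = Σ_{i≥0} Y_i xⁱ/i!.  Since A is also a right inverse of the triangular
-- matrix (B_{m,j}), g(x) = Σ_i A_{i,1} xⁱ/i! is the compositional inverse of a(x).
-- Writing a = x·F and g = x·G this says G(x·F)·F = 1, and with N = n − k the
-- statement becomes Lagrange inversion  k·[x^N] G^{−(k+N)} = (k+N)·[x^N] F^k.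
-- For that, expand F^{k−1}(xF)′ = (G^{−n} ∘ xF)·F^{−N−1}(xF)′ and use
-- r·[x^M] F^{r−1}(xF)′ = (r+M)·[x^M] F^r, which at r = −m shows that
-- [x^m] F^{−m−1}(xF)′ vanishes for m > 0.
module Submission where

open import Defs
open import Data.Nat using (ℕ; suc)
open import Data.Integer as ℤ using (ℤ; 0ℤ)
open import Relation.Binary.PropositionalEquality using (_≢_)
open import Relation.Nullary using (¬_)

open import Algebra.Bundles using (CommutativeSemiring; Semiring)
open import Algebra.Structures.Biased using (IsCommutativeSemiringˡ)
import Algebra.Properties.CommutativeSemiring.Exp as CommSemiringExp
import Algebra.Properties.Ring as RingProperties
import Algebra.Properties.Semiring.Binomial as SemiringBinomial
import Algebra.Properties.Semiring.Exp as SemiringExp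
import Algebra.Properties.Semiring.Mult as SemiringMult
import Algebra.Properties.CommutativeSemigroup as CommSemigroupProperties
import Algebra.Solver.CommutativeMonoid as CommMonoidSolver
import Algebra.Definitions.RawMonoid as RawMonoidDefs
open import Data.Bool using (Bool; true; false; if_then_else_; _∧_)
open import Data.Empty using (⊥-elim)
open import Data.Fin using (toℕ)
open import Data.Integer using (+_; -[1+_])
import Data.Integer.Properties as ℤP
open import Data.Integer.Tactic.RingSolver using (solve-∀)
open import Data.List using (List; []; _∷_; map; concatMap; _++_; upTo; applyUpTo)
open import Data.Nat as ℕ using (zero; _<_; _≤_; z≤n; s≤s; _∸_; _!; _≡ᵇ_; _≤ᵇ_; _≤?_; _<?_; _≟_)
open import Data.Nat.Combinatorics using (_C_; nCk≡n!/k![n-k]!; k![n∸k]!∣n!)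
open import Data.Nat.DivMod using (m/n*n≡m)
import Data.Nat.Properties as ℕP
open import Data.Product using (_×_; _,_)
open import Data.Sum using (_⊎_; inj₁; inj₂)
open import Function using (_∘_; id)
open import Relation.Binary.Definitions using (tri<; tri≈; tri>)
import Relation.Binary.Reasoning.Setoid as SetoidReasoning
open import Relation.Binary.Structures using (IsEquivalence)
open import Relation.Binary.PropositionalEquality as ≡ using (_≡_)
open import Relation.Nullary using (Dec; yes; no)
open import Relation.Nullary.Decidable using (dec-true; dec-false)

+[1+n]≡+n+1 : ∀ n → + suc n ≡ + n ℤ.+ + 1
+[1+n]≡+n+1 n = ≡.cong +_ (ℕP.+-comm 1 n)

i-1+1≡i : ∀ i → i ℤ.- + 1 ℤ.+ + 1 ≡ i
i-1+1≡i = solve-∀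

-+n-1≡-[1+n] : ∀ n → ℤ.- (+ n) ℤ.- + 1 ≡ -[1+ n ]
-+n-1≡-[1+n] zero    = ≡.refl
-+n-1≡-[1+n] (suc n) = ≡.cong (λ z → -[1+ suc z ]) (ℕP.+-identityʳ n)

module FieldProperties {c ℓ} (K : CharZeroField c ℓ) where

  open CharZeroField K public hiding (zero)
  open RingProperties ring public using (-‿distribʳ-*; -‿involutive; -0#≈0#; -‿anti-homo-+)
  open SetoidReasoning setoid public

  module +-Solver = CommMonoidSolver +-commutativeMonoid
  module *-Solver = CommMonoidSolver *-commutativeMonoid
  open CommSemigroupProperties +-commutativeSemigroup public
    using () renaming (interchange to +-interchange; x∙yz≈y∙xz to x+yz≈y+xz)
  open CommSemigroupProperties *-commutativeSemigroup public
    using () renaming (interchange to *-interchange; x∙yz≈y∙xz to x*yz≈y*xz; xy∙z≈xz∙y to xy*z≈xz*y)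

  ≡⇒≈ : ∀ {x y} → x ≡ y → x ≈ y
  ≡⇒≈ ≡.refl = refl

  x-y≈0⇒x≈y : ∀ {x y} → x + - y ≈ 0# → x ≈ y
  x-y≈0⇒x≈y {x} {y} p = begin
    x              ≈⟨ sym (+-identityʳ x) ⟩
    x + 0#         ≈⟨ +-congˡ (sym (-‿inverseˡ y)) ⟩
    x + (- y + y)  ≈⟨ sym (+-assoc x (- y) y) ⟩
    (x + - y) + y  ≈⟨ +-congʳ p ⟩
    0# + y         ≈⟨ +-identityˡ y ⟩
    y              ∎

  ≉0-resp-≈ : ∀ {x y} → x ≈ y → x ≉ 0# → y ≉ 0#
  ≉0-resp-≈ p x≉0 q = x≉0 (trans p q)

  inverseˡ : ∀ x → x ≉ 0# → (x ⁻¹) * x ≈ 1#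
  inverseˡ x x≉0 = trans (*-comm _ _) (inverseʳ x x≉0)

  *-cancelˡ : ∀ {x a b} → x ≉ 0# → x * a ≈ x * b → a ≈ b
  *-cancelˡ {x} {a} {b} x≉0 p = begin
    a                 ≈⟨ sym (*-identityˡ a) ⟩
    1# * a            ≈⟨ *-congʳ (sym (inverseˡ x x≉0)) ⟩
    ((x ⁻¹) * x) * a  ≈⟨ *-assoc _ _ _ ⟩
    (x ⁻¹) * (x * a)  ≈⟨ *-congˡ p ⟩
    (x ⁻¹) * (x * b)  ≈⟨ sym (*-assoc _ _ _) ⟩
    ((x ⁻¹) * x) * b  ≈⟨ *-congʳ (inverseˡ x x≉0) ⟩
    1# * b            ≈⟨ *-identityˡ b ⟩
    b                 ∎

  ⁻¹-unique : ∀ {x y} → x ≉ 0# → x * y ≈ 1# → x ⁻¹ ≈ y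
  ⁻¹-unique {x} x≉0 p = *-cancelˡ x≉0 (trans (inverseʳ x x≉0) (sym p))

  *-≉0 : ∀ {x y} → x ≉ 0# → y ≉ 0# → x * y ≉ 0#
  *-≉0 {x} {y} x≉0 y≉0 xy≈0 = y≉0 (*-cancelˡ x≉0 (trans xy≈0 (sym (zeroʳ x))))

  ⁻¹-≉0 : ∀ {x} → x ≉ 0# → x ⁻¹ ≉ 0#
  ⁻¹-≉0 {x} x≉0 p = 1≉0 (trans (sym (inverseʳ x x≉0)) (trans (*-congˡ p) (zeroʳ x)))

  ⁻¹-distrib-* : ∀ {x y} → x ≉ 0# → y ≉ 0# → (x * y) ⁻¹ ≈ (x ⁻¹) * (y ⁻¹)
  ⁻¹-distrib-* {x} {y} x≉0 y≉0 = ⁻¹-unique (*-≉0 x≉0 y≉0) (begin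
    (x * y) * ((x ⁻¹) * (y ⁻¹))  ≈⟨ *-interchange x y (x ⁻¹) (y ⁻¹) ⟩
    (x * (x ⁻¹)) * (y * (y ⁻¹))  ≈⟨ *-cong (inverseʳ x x≉0) (inverseʳ y y≉0) ⟩
    1# * 1#                      ≈⟨ *-identityˡ 1# ⟩
    1#                           ∎)

  ⁻¹-cong : ∀ {x y} → x ≉ 0# → x ≈ y → x ⁻¹ ≈ y ⁻¹
  ⁻¹-cong {x} {y} x≉0 p = ⁻¹-unique x≉0 (trans (*-congʳ p) (inverseʳ y (≉0-resp-≈ p x≉0)))

  1⁻¹≈1 : 1# ⁻¹ ≈ 1#
  1⁻¹≈1 = ⁻¹-unique 1≉0 (*-identityˡ 1#)

  open SemiringExp semiring using () renaming (_^_ to _^ᴸ_)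

  ^≡^ᴸ : ∀ x n → x ^ n ≡ x ^ᴸ n
  ^≡^ᴸ x zero    = ≡.refl
  ^≡^ᴸ x (suc n) = ≡.cong (x *_) (^≡^ᴸ x n)

  ^-homo-* : ∀ x m n → x ^ (m ℕ.+ n) ≈ (x ^ m) * (x ^ n)
  ^-homo-* x m n rewrite ^≡^ᴸ x (m ℕ.+ n) | ^≡^ᴸ x m | ^≡^ᴸ x n = SemiringExp.^-homo-* semiring x m n

  ^-distrib-* : ∀ x y n → (x * y) ^ n ≈ (x ^ n) * (y ^ n)
  ^-distrib-* x y n rewrite ^≡^ᴸ (x * y) n | ^≡^ᴸ x n | ^≡^ᴸ y n = CommSemiringExp.^-distrib-* commutativeSemiring x y n

  ^-congˡ : ∀ {x y} n → x ≈ y → x ^ n ≈ y ^ n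
  ^-congˡ zero    p = refl
  ^-congˡ (suc n) p = *-cong p (^-congˡ n p)

  1^n≈1 : ∀ n → 1# ^ n ≈ 1#
  1^n≈1 zero    = refl
  1^n≈1 (suc n) = trans (*-identityˡ _) (1^n≈1 n)

  ^-≉0 : ∀ {x} n → x ≉ 0# → x ^ n ≉ 0#
  ^-≉0 zero    x≉0 = 1≉0
  ^-≉0 (suc n) x≉0 = *-≉0 x≉0 (^-≉0 n x≉0)

  ^-⁻¹ : ∀ {x} n → x ≉ 0# → (x ^ n) ⁻¹ ≈ (x ⁻¹) ^ n
  ^-⁻¹ {x} n x≉0 = ⁻¹-unique (^-≉0 n x≉0) (begin
    x ^ n * (x ⁻¹) ^ n  ≈⟨ sym (^-distrib-* x (x ⁻¹) n) ⟩
    (x * x ⁻¹) ^ n      ≈⟨ ^-congˡ n (inverseʳ x x≉0) ⟩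
    1# ^ n              ≈⟨ 1^n≈1 n ⟩
    1#                  ∎)

  open RawMonoidDefs +-rawMonoid using () renaming (_×_ to _×ᴹ_)

  fromℕ≡×1 : ∀ n → fromℕ n ≡ n ×ᴹ 1#
  fromℕ≡×1 zero    = ≡.refl
  fromℕ≡×1 (suc n) = ≡.cong (λ z → 1# + z) (fromℕ≡×1 n)

  fromℕ-* : ∀ m n → fromℕ (m ℕ.* n) ≈ fromℕ m * fromℕ n
  fromℕ-* m n rewrite fromℕ≡×1 (m ℕ.* n) | fromℕ≡×1 m | fromℕ≡×1 n = SemiringMult.×1-homo-* semiring m n

  fromℕ-^ : ∀ m n → fromℕ (m ℕ.^ n) ≈ fromℕ m ^ n
  fromℕ-^ m zero    = +-identityʳ 1#
  fromℕ-^ m (suc n) = trans (fromℕ-* m (m ℕ.^ n)) (*-congˡ (fromℕ-^ m n))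

  fromℕ-1 : fromℕ 1 ≈ 1#
  fromℕ-1 = +-identityʳ 1#

  n!≉0 : ∀ n → fromℕ (n !) ≉ 0#
  n!≉0 zero    = ≉0-resp-≈ (sym fromℕ-1) 1≉0
  n!≉0 (suc n) = ≉0-resp-≈ (sym (fromℕ-* (suc n) (n !))) (*-≉0 (charZero n) (n!≉0 n))

  [1+n]!⁻¹ : ∀ n → fromℕ (suc n !) ⁻¹ ≈ (fromℕ (suc n) ⁻¹) * (fromℕ (n !) ⁻¹)
  [1+n]!⁻¹ n = trans (⁻¹-cong (n!≉0 (suc n)) (fromℕ-* (suc n) (n !))) (⁻¹-distrib-* (charZero n) (n!≉0 n))

  ℤ-induction : ∀ {p} (Q : ℤ → Set p) → Q (+ 0) →
                (∀ i → Q i → Q (i ℤ.+ + 1)) → (∀ i → Q i → Q (i ℤ.- + 1)) → ∀ i → Q i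
  ℤ-induction Q q₀ qs qp (+ zero)    = q₀
  ℤ-induction Q q₀ qs qp (+ suc n)   =
    ≡.subst Q (≡.cong +_ (ℕP.+-comm n 1)) (qs (+ n) (ℤ-induction Q q₀ qs qp (+ n)))
  ℤ-induction Q q₀ qs qp -[1+ zero ]  = qp (+ 0) q₀
  ℤ-induction Q q₀ qs qp -[1+ suc n ] =
    ≡.subst Q (≡.cong (λ m → -[1+ suc m ]) (ℕP.+-identityʳ n)) (qp -[1+ n ] (ℤ-induction Q q₀ qs qp -[1+ n ]))

  fromℤ-suc : ∀ i → fromℤ (i ℤ.+ + 1) ≈ fromℤ i + 1#
  fromℤ-suc (+ n)         = trans (≡⇒≈ (≡.cong fromℕ (ℕP.+-comm n 1))) (+-comm _ _)
  fromℤ-suc -[1+ zero ]   = sym (trans (+-congʳ (-‿cong (+-identityʳ 1#))) (-‿inverseˡ 1#))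
  fromℤ-suc -[1+ suc n ]  = sym (begin
    - (1# + (1# + fromℕ n)) + 1#    ≈⟨ +-congʳ (-‿cong (+-comm 1# _)) ⟩
    - ((1# + fromℕ n) + 1#) + 1#    ≈⟨ +-congʳ (-‿anti-homo-+ _ _) ⟩
    (- 1# + - (1# + fromℕ n)) + 1#  ≈⟨ +-congʳ (+-comm _ _) ⟩
    (- (1# + fromℕ n) + - 1#) + 1#  ≈⟨ +-assoc _ _ _ ⟩
    - (1# + fromℕ n) + (- 1# + 1#)  ≈⟨ +-congˡ (-‿inverseˡ 1#) ⟩
    - (1# + fromℕ n) + 0#           ≈⟨ +-identityʳ _ ⟩
    - (1# + fromℕ n)                ∎)

  fromℤ-pred : ∀ i → fromℤ (i ℤ.- + 1) ≈ fromℤ i + - 1#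
  fromℤ-pred i = begin
    fromℤ (i ℤ.- + 1)                 ≈⟨ sym (+-identityʳ _) ⟩
    fromℤ (i ℤ.- + 1) + 0#            ≈⟨ +-congˡ (sym (-‿inverseʳ 1#)) ⟩
    fromℤ (i ℤ.- + 1) + (1# + - 1#)   ≈⟨ sym (+-assoc _ _ _) ⟩
    (fromℤ (i ℤ.- + 1) + 1#) + - 1#   ≈⟨ +-congʳ (sym (fromℤ-suc (i ℤ.- + 1))) ⟩
    fromℤ (i ℤ.- + 1 ℤ.+ + 1) + - 1#  ≈⟨ +-congʳ (≡⇒≈ (≡.cong fromℤ (i-1+1≡i i))) ⟩
    fromℤ i + - 1#                    ∎

  fromℤ-+ : ∀ i j → fromℤ (i ℤ.+ j) ≈ fromℤ i + fromℤ j
  fromℤ-+ i = ℤ-induction (λ j → fromℤ (i ℤ.+ j) ≈ fromℤ i + fromℤ j)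
    (trans (≡⇒≈ (≡.cong fromℤ (ℤP.+-identityʳ i))) (sym (+-identityʳ _)))
    (λ j h → begin
       fromℤ (i ℤ.+ (j ℤ.+ + 1))   ≈⟨ ≡⇒≈ (≡.cong fromℤ (≡.sym (ℤP.+-assoc i j (+ 1)))) ⟩
       fromℤ (i ℤ.+ j ℤ.+ + 1)     ≈⟨ fromℤ-suc (i ℤ.+ j) ⟩
       fromℤ (i ℤ.+ j) + 1#        ≈⟨ +-congʳ h ⟩
       (fromℤ i + fromℤ j) + 1#    ≈⟨ +-assoc _ _ _ ⟩
       fromℤ i + (fromℤ j + 1#)    ≈⟨ +-congˡ (sym (fromℤ-suc j)) ⟩
       fromℤ i + fromℤ (j ℤ.+ + 1) ∎)
    (λ j h → begin
       fromℤ (i ℤ.+ (j ℤ.- + 1))   ≈⟨ ≡⇒≈ (≡.cong fromℤ (≡.sym (ℤP.+-assoc i j (ℤ.- + 1)))) ⟩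
       fromℤ (i ℤ.+ j ℤ.- + 1)     ≈⟨ fromℤ-pred (i ℤ.+ j) ⟩
       fromℤ (i ℤ.+ j) + - 1#      ≈⟨ +-congʳ h ⟩
       (fromℤ i + fromℤ j) + - 1#  ≈⟨ +-assoc _ _ _ ⟩
       fromℤ i + (fromℤ j + - 1#)  ≈⟨ +-congˡ (sym (fromℤ-pred j)) ⟩
       fromℤ i + fromℤ (j ℤ.- + 1) ∎)

  fromℤ-+ℕ*ℤ : ∀ m i → fromℤ (+ m ℤ.* i) ≈ fromℕ m * fromℤ i
  fromℤ-+ℕ*ℤ zero    i = sym (zeroˡ _)
  fromℤ-+ℕ*ℤ (suc m) i = begin
    fromℤ (+ suc m ℤ.* i)                ≈⟨ ≡⇒≈ (≡.cong fromℤ (ℤP.*-distribʳ-+ i (+ 1) (+ m))) ⟩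
    fromℤ (+ 1 ℤ.* i ℤ.+ + m ℤ.* i)      ≈⟨ fromℤ-+ (+ 1 ℤ.* i) (+ m ℤ.* i) ⟩
    fromℤ (+ 1 ℤ.* i) + fromℤ (+ m ℤ.* i) ≈⟨ +-cong (≡⇒≈ (≡.cong fromℤ (ℤP.*-identityˡ i))) (fromℤ-+ℕ*ℤ m i) ⟩
    fromℤ i + fromℕ m * fromℤ i          ≈⟨ +-congʳ (sym (*-identityˡ _)) ⟩
    1# * fromℤ i + fromℕ m * fromℤ i     ≈⟨ sym (distribʳ _ _ _) ⟩
    fromℕ (suc m) * fromℤ i              ∎

  fromℤ-≉0 : ∀ i → i ≢ 0ℤ → fromℤ i ≉ 0#
  fromℤ-≉0 (+ zero)   i≢0 = ⊥-elim (i≢0 ≡.refl)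
  fromℤ-≉0 (+ suc n)  i≢0 = charZero n
  fromℤ-≉0 -[1+ n ]   i≢0 p = charZero n (trans (sym (-‿involutive _)) (trans (-‿cong p) -0#≈0#))

module FiniteSums {c ℓ} (K : CharZeroField c ℓ) where

  open FieldProperties K public

  Σ : ℕ → (ℕ → Carrier) → Carrier
  Σ zero    f = 0#
  Σ (suc l) f = f 0 + Σ l (f ∘ suc)

  Σ-cong-≡ : ∀ l {f g} → (∀ i → f i ≡ g i) → Σ l f ≡ Σ l g
  Σ-cong-≡ zero    e = ≡.refl
  Σ-cong-≡ (suc l) e = ≡.cong₂ _+_ (e 0) (Σ-cong-≡ l (e ∘ suc))

  sumRange≡Σ : ∀ a l f → sumRange a l f ≡ Σ l (λ i → f (a ℕ.+ i))
  sumRange≡Σ a zero    f = ≡.refl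
  sumRange≡Σ a (suc l) f = ≡.cong₂ _+_ (≡.cong f (≡.sym (ℕP.+-identityʳ a)))
    (≡.trans (sumRange≡Σ (suc a) l f) (Σ-cong-≡ l (λ i → ≡.cong f (≡.sym (ℕP.+-suc a i)))))

  Σ-cong-< : ∀ l {f g} → (∀ i → i < l → f i ≈ g i) → Σ l f ≈ Σ l g
  Σ-cong-< zero    e = refl
  Σ-cong-< (suc l) e = +-cong (e 0 (s≤s z≤n)) (Σ-cong-< l (λ i i<l → e (suc i) (s≤s i<l)))

  Σ-cong : ∀ l {f g} → (∀ i → f i ≈ g i) → Σ l f ≈ Σ l g
  Σ-cong l e = Σ-cong-< l (λ i _ → e i)

  Σ-zero : ∀ l f → (∀ i → i < l → f i ≈ 0#) → Σ l f ≈ 0#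
  Σ-zero zero    f e = refl
  Σ-zero (suc l) f e = trans (+-cong (e 0 (s≤s z≤n)) (Σ-zero l (f ∘ suc) (λ i i<l → e (suc i) (s≤s i<l)))) (+-identityˡ 0#)

  Σ-distrib-+ : ∀ l f g → Σ l (λ i → f i + g i) ≈ Σ l f + Σ l g
  Σ-distrib-+ zero    f g = sym (+-identityʳ 0#)
  Σ-distrib-+ (suc l) f g = trans (+-congˡ (Σ-distrib-+ l (f ∘ suc) (g ∘ suc)))
    (+-interchange _ _ _ _)

  *-distribˡ-Σ : ∀ l x f → x * Σ l f ≈ Σ l (λ i → x * f i)
  *-distribˡ-Σ zero    x f = zeroʳ x
  *-distribˡ-Σ (suc l) x f = trans (distribˡ _ _ _) (+-congˡ (*-distribˡ-Σ l x (f ∘ suc)))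

  *-distribʳ-Σ : ∀ l x f → Σ l f * x ≈ Σ l (λ i → f i * x)
  *-distribʳ-Σ l x f = trans (*-comm _ _) (trans (*-distribˡ-Σ l x f) (Σ-cong l (λ i → *-comm _ _)))

  -‿distrib-Σ : ∀ l f → - Σ l f ≈ Σ l (λ i → - f i)
  -‿distrib-Σ zero    f = -0#≈0#
  -‿distrib-Σ (suc l) f = trans (-‿anti-homo-+ _ _) (trans (+-comm _ _) (+-congˡ (-‿distrib-Σ l (f ∘ suc))))

  Σ-init-last : ∀ l f → Σ (suc l) f ≈ Σ l f + f l
  Σ-init-last zero    f = trans (+-identityʳ _) (sym (+-identityˡ _))
  Σ-init-last (suc l) f = trans (+-congˡ (Σ-init-last l (f ∘ suc))) (sym (+-assoc _ _ _))

  Σ-split : ∀ l m f → Σ (l ℕ.+ m) f ≈ Σ l f + Σ m (λ i → f (l ℕ.+ i))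
  Σ-split zero    m f = sym (+-identityˡ _)
  Σ-split (suc l) m f = trans (+-congˡ (Σ-split l m (f ∘ suc))) (sym (+-assoc _ _ _))

  Σ-single : ∀ l f p → p < l → (∀ i → i < l → i ≢ p → f i ≈ 0#) → Σ l f ≈ f p
  Σ-single (suc l) f zero    p<l e =
    trans (+-congˡ (Σ-zero l (f ∘ suc) (λ i i<l → e (suc i) (s≤s i<l) (λ ())))) (+-identityʳ _)
  Σ-single (suc l) f (suc p) (s≤s p<l) e = trans (+-congʳ (e 0 (s≤s z≤n) (λ ())))
    (trans (+-identityˡ _) (Σ-single l (f ∘ suc) p p<l (λ i i<l i≢p → e (suc i) (s≤s i<l) (i≢p ∘ ℕP.suc-injective))))

  Σ-comm : ∀ l m (h : ℕ → ℕ → Carrier) → Σ l (λ i → Σ m (h i)) ≈ Σ m (λ j → Σ l (λ i → h i j))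
  Σ-comm zero    m h = sym (Σ-zero m _ (λ _ _ → refl))
  Σ-comm (suc l) m h = trans (+-congˡ (Σ-comm l m (h ∘ suc))) (sym (Σ-distrib-+ m (h 0) _))

  Σ-truncate : ∀ l m f → l ≤ m → (∀ i → l ≤ i → i < m → f i ≈ 0#) → Σ m f ≈ Σ l f
  Σ-truncate l m f l≤m e = begin
    Σ m f                                     ≡⟨ ≡.cong (λ z → Σ z f) (≡.sym (ℕP.m+[n∸m]≡n l≤m)) ⟩
    Σ (l ℕ.+ (m ∸ l)) f                       ≈⟨ Σ-split l (m ∸ l) f ⟩
    Σ l f + Σ (m ∸ l) (λ i → f (l ℕ.+ i))     ≈⟨ +-congˡ (Σ-zero (m ∸ l) _ tail≈0) ⟩
    Σ l f + 0#                                ≈⟨ +-identityʳ _ ⟩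
    Σ l f                                     ∎
    where
    tail≈0 : ∀ i → i < m ∸ l → f (l ℕ.+ i) ≈ 0#
    tail≈0 i i<m-l = e (l ℕ.+ i) (ℕP.m≤m+n l i)
      (≡.subst (l ℕ.+ i <_) (ℕP.m+[n∸m]≡n l≤m) (ℕP.+-monoʳ-< l i<m-l))

module PowerSeries {c ℓ} (K : CharZeroField c ℓ) where

  open FiniteSums K public

  Series : Set c
  Series = ℕ → Carrier

  infix 4 _≋_
  _≋_ : Series → Series → Set ℓ
  a ≋ b = ∀ n → a n ≈ b n

  ≋-refl : ∀ {a} → a ≋ a
  ≋-refl n = refl

  ≋-sym : ∀ {a b} → a ≋ b → b ≋ a
  ≋-sym p n = sym (p n)

  ≋-trans : ∀ {a b d} → a ≋ b → b ≋ d → a ≋ d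
  ≋-trans p q n = trans (p n) (q n)

  0ₛ : Series
  0ₛ _ = 0#

  1ₛ : Series
  1ₛ zero = 1#
  1ₛ (suc n) = 0#

  infixl 6 _+ₛ_
  _+ₛ_ : Series → Series → Series
  (a +ₛ b) n = a n + b n

  scale : Carrier → Series → Series
  scale x a n = x * a n

  tail : Series → Series
  tail a n = a (suc n)

  shift : Series → Series
  shift a zero = 0#
  shift a (suc n) = a n

  mul : Series → Series → Series
  mul a b zero = a 0 * b 0
  mul a b (suc n) = a 0 * b (suc n) + mul (tail a) b n

  deriv : Series → Series
  deriv a n = fromℕ (suc n) * a (suc n)

  pow : Series → ℕ → Series
  pow a zero = 1ₛ
  pow a (suc j) = mul a (pow a j)

  shiftBy : ℕ → Series → Series
  shiftBy zero a = a
  shiftBy (suc p) a = shift (shiftBy p a)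

  Σₛ : ℕ → (ℕ → Series) → Series
  Σₛ l F n = Σ l (λ i → F i n)

  +ₛ-cong : ∀ {a a' b b'} → a ≋ a' → b ≋ b' → a +ₛ b ≋ a' +ₛ b'
  +ₛ-cong p q n = +-cong (p n) (q n)

  scale-cong : ∀ {x y a b} → x ≈ y → a ≋ b → scale x a ≋ scale y b
  scale-cong p q n = *-cong p (q n)

  shift-cong : ∀ {a b} → a ≋ b → shift a ≋ shift b
  shift-cong p zero = refl
  shift-cong p (suc n) = p n

  deriv-cong : ∀ {a b} → a ≋ b → deriv a ≋ deriv b
  deriv-cong p n = *-congˡ (p (suc n))

  mul-cong-≤ : ∀ n {a a' b b'} → (∀ i → i ≤ n → a i ≈ a' i) → (∀ i → i ≤ n → b i ≈ b' i) → mul a b n ≈ mul a' b' n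
  mul-cong-≤ zero p q = *-cong (p 0 z≤n) (q 0 z≤n)
  mul-cong-≤ (suc n) p q = +-cong (*-cong (p 0 z≤n) (q (suc n) ℕP.≤-refl))
    (mul-cong-≤ n (λ i i≤n → p (suc i) (s≤s i≤n)) (λ i i≤n → q i (ℕP.m≤n⇒m≤1+n i≤n)))

  mul-cong : ∀ {a a' b b'} → a ≋ a' → b ≋ b' → mul a b ≋ mul a' b'
  mul-cong p q n = mul-cong-≤ n (λ i _ → p i) (λ i _ → q i)

  pow-cong : ∀ {a b} j → a ≋ b → pow a j ≋ pow b j
  pow-cong zero p = ≋-refl
  pow-cong (suc j) p = mul-cong p (pow-cong j p)

  Σₛ-cong : ∀ l {F G} → (∀ i → i < l → F i ≋ G i) → Σₛ l F ≋ Σₛ l G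
  Σₛ-cong l e n = Σ-cong-< l (λ i i<l → e i i<l n)

  mul-unfold : ∀ a b → mul a b ≋ scale (a 0) b +ₛ shift (mul (tail a) b)
  mul-unfold a b zero = sym (+-identityʳ _)
  mul-unfold a b (suc n) = refl

  mul-distribʳ : ∀ a b d → mul (a +ₛ b) d ≋ mul a d +ₛ mul b d
  mul-distribʳ a b d zero = distribʳ _ _ _
  mul-distribʳ a b d (suc n) = trans (+-cong (distribʳ _ _ _) (mul-distribʳ (tail a) (tail b) d n))
    (+-interchange _ _ _ _)

  mul-distribˡ : ∀ a b d → mul a (b +ₛ d) ≋ mul a b +ₛ mul a d
  mul-distribˡ a b d zero = distribˡ _ _ _
  mul-distribˡ a b d (suc n) = trans (+-cong (distribˡ _ _ _) (mul-distribˡ (tail a) b d n))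
    (+-interchange _ _ _ _)

  mul-scaleˡ : ∀ x a b → mul (scale x a) b ≋ scale x (mul a b)
  mul-scaleˡ x a b zero = *-assoc _ _ _
  mul-scaleˡ x a b (suc n) = trans (+-cong (*-assoc _ _ _) (mul-scaleˡ x (tail a) b n)) (sym (distribˡ _ _ _))

  mul-scaleʳ : ∀ x a b → mul a (scale x b) ≋ scale x (mul a b)
  mul-scaleʳ x a b zero = x*yz≈y*xz _ _ _
  mul-scaleʳ x a b (suc n) = trans (+-cong (x*yz≈y*xz _ _ _) (mul-scaleʳ x (tail a) b n)) (sym (distribˡ _ _ _))

  mul-zeroˡ : ∀ b → mul 0ₛ b ≋ 0ₛ
  mul-zeroˡ b zero = zeroˡ _
  mul-zeroˡ b (suc n) = trans (+-cong (zeroˡ _) (mul-zeroˡ b n)) (+-identityʳ _)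

  mul-shiftˡ : ∀ a b → mul (shift a) b ≋ shift (mul a b)
  mul-shiftˡ a b zero = zeroˡ _
  mul-shiftˡ a b (suc n) = trans (+-congʳ (zeroˡ _)) (+-identityˡ _)

  mul-identityˡ : ∀ b → mul 1ₛ b ≋ b
  mul-identityˡ b zero = *-identityˡ _
  mul-identityˡ b (suc n) = trans (+-cong (*-identityˡ _) (mul-zeroˡ b n)) (+-identityʳ _)

  mul-suc-horner : ∀ n a b → mul a b (suc n) ≈ a (suc n) * b 0 + mul a (tail b) n
  mul-suc-horner zero a b = +-comm _ _
  mul-suc-horner (suc n) a b = begin
    a 0 * b (suc (suc n)) + mul (tail a) b (suc n) ≈⟨ +-congˡ (mul-suc-horner n (tail a) b) ⟩
    a 0 * b (suc (suc n)) + (a (suc (suc n)) * b 0 + mul (tail a) (tail b) n) ≈⟨ x+yz≈y+xz _ _ _ ⟩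
    a (suc (suc n)) * b 0 + (a 0 * b (suc (suc n)) + mul (tail a) (tail b) n) ∎

  mul-comm : ∀ a b → mul a b ≋ mul b a
  mul-comm a b zero = *-comm _ _
  mul-comm a b (suc n) = begin
    a 0 * b (suc n) + mul (tail a) b n ≈⟨ +-cong (*-comm _ _) (mul-comm (tail a) b n) ⟩
    b (suc n) * a 0 + mul b (tail a) n ≈⟨ sym (mul-suc-horner n b a) ⟩
    mul b a (suc n) ∎

  mul-identityʳ : ∀ b → mul b 1ₛ ≋ b
  mul-identityʳ b = ≋-trans (mul-comm b 1ₛ) (mul-identityˡ b)

  mul-zeroʳ : ∀ b → mul b 0ₛ ≋ 0ₛ
  mul-zeroʳ b = ≋-trans (mul-comm b 0ₛ) (mul-zeroˡ b)

  mul-shiftʳ : ∀ a b → mul a (shift b) ≋ shift (mul a b)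
  mul-shiftʳ a b = ≋-trans (mul-comm a (shift b)) (≋-trans (mul-shiftˡ b a) (shift-cong (mul-comm b a)))

  mul-assoc : ∀ a b d → mul (mul a b) d ≋ mul a (mul b d)
  mul-assoc a b d n = go n a
    where
    go : ∀ n a → mul (mul a b) d n ≈ mul a (mul b d) n
    go n a = begin
      mul (mul a b) d n ≈⟨ mul-cong (mul-unfold a b) ≋-refl n ⟩
      mul (scale (a 0) b +ₛ shift (mul (tail a) b)) d n ≈⟨ mul-distribʳ _ _ d n ⟩
      mul (scale (a 0) b) d n + mul (shift (mul (tail a) b)) d n ≈⟨ +-cong (mul-scaleˡ _ b d n) (mul-shiftˡ _ d n) ⟩
      a 0 * mul b d n + shift (mul (mul (tail a) b) d) n ≈⟨ +-congˡ (lem n) ⟩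
      a 0 * mul b d n + shift (mul (tail a) (mul b d)) n ≈⟨ sym (mul-unfold a (mul b d) n) ⟩
      mul a (mul b d) n ∎
      where
      lem : ∀ n → shift (mul (mul (tail a) b) d) n ≈ shift (mul (tail a) (mul b d)) n
      lem zero = refl
      lem (suc n) = go n (tail a)

  mul-Σₛʳ : ∀ l a F → mul a (Σₛ l F) ≋ Σₛ l (λ i → mul a (F i))
  mul-Σₛʳ zero a F = mul-zeroʳ a
  mul-Σₛʳ (suc l) a F = ≋-trans (mul-distribˡ a (F 0) _) (+ₛ-cong ≋-refl (mul-Σₛʳ l a (F ∘ suc)))

  mul-Σₛˡ : ∀ l a F → mul (Σₛ l F) a ≋ Σₛ l (λ i → mul (F i) a)
  mul-Σₛˡ l a F = ≋-trans (mul-comm _ a) (≋-trans (mul-Σₛʳ l a F) (Σₛ-cong l (λ i _ → mul-comm a (F i))))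

  deriv-+ : ∀ a b → deriv (a +ₛ b) ≋ deriv a +ₛ deriv b
  deriv-+ a b n = distribˡ _ _ _

  deriv-scale : ∀ x a → deriv (scale x a) ≋ scale x (deriv a)
  deriv-scale x a n = x*yz≈y*xz _ _ _

  deriv-shift : ∀ u → deriv (shift u) ≋ u +ₛ shift (deriv u)
  deriv-shift u zero = trans (*-congʳ fromℕ-1) (trans (*-identityˡ _) (sym (+-identityʳ _)))
  deriv-shift u (suc n) = begin
    fromℕ (suc (suc n)) * u (suc n) ≈⟨ distribʳ _ _ _ ⟩
    1# * u (suc n) + fromℕ (suc n) * u (suc n) ≈⟨ +-congʳ (*-identityˡ _) ⟩
    u (suc n) + fromℕ (suc n) * u (suc n) ∎

  deriv-1ₛ : deriv 1ₛ ≋ 0ₛ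
  deriv-1ₛ n = zeroʳ _

  head+shift-tail : ∀ a → a ≋ scale (a 0) 1ₛ +ₛ shift (tail a)
  head+shift-tail a zero = sym (trans (+-identityʳ _) (*-identityʳ _))
  head+shift-tail a (suc n) = sym (trans (+-congʳ (zeroʳ _)) (+-identityˡ _))

  deriv-head+shift-tail : ∀ a → deriv a ≋ tail a +ₛ shift (deriv (tail a))
  deriv-head+shift-tail a n = begin
    deriv a n                                               ≈⟨ deriv-cong (head+shift-tail a) n ⟩
    deriv (scale (a 0) 1ₛ +ₛ shift (tail a)) n              ≈⟨ deriv-+ (scale (a 0) 1ₛ) (shift (tail a)) n ⟩
    deriv (scale (a 0) 1ₛ) n + deriv (shift (tail a)) n     ≈⟨ +-cong (trans (deriv-scale (a 0) 1ₛ n) (*-congˡ (deriv-1ₛ n)))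
                                                                      (deriv-shift (tail a) n) ⟩
    a 0 * 0# + (tail a +ₛ shift (deriv (tail a))) n         ≈⟨ trans (+-congʳ (zeroʳ _)) (+-identityˡ _) ⟩
    (tail a +ₛ shift (deriv (tail a))) n                    ∎

  deriv-mul : ∀ a b → deriv (mul a b) ≋ mul (deriv a) b +ₛ mul a (deriv b)
  deriv-mul a b n = go n a
    where
    go : ∀ n a → deriv (mul a b) n ≈ (mul (deriv a) b +ₛ mul a (deriv b)) n
    go n a = begin
      deriv (mul a b) n
        ≈⟨ deriv-cong (mul-unfold a b) n ⟩
      deriv (scale (a 0) b +ₛ shift (mul (tail a) b)) n
        ≈⟨ deriv-+ (scale (a 0) b) (shift (mul (tail a) b)) n ⟩
      deriv (scale (a 0) b) n + deriv (shift (mul (tail a) b)) n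
        ≈⟨ +-cong (deriv-scale (a 0) b n) (deriv-shift (mul (tail a) b) n) ⟩
      a 0 * deriv b n + (mul (tail a) b n + shift (deriv (mul (tail a) b)) n)
        ≈⟨ +-congˡ (+-congˡ (shifted n)) ⟩
      a 0 * deriv b n + (mul (tail a) b n + (shift (mul (deriv (tail a)) b) n + shift (mul (tail a) (deriv b)) n))
        ≈⟨ +-Solver.solve 4 (λ p q r s → p ⊕ (q ⊕ (r ⊕ s)) ⊜ (q ⊕ r) ⊕ (p ⊕ s)) refl _ _ _ _ ⟩
      (mul (tail a) b n + shift (mul (deriv (tail a)) b) n) + (a 0 * deriv b n + shift (mul (tail a) (deriv b)) n)
        ≈⟨ +-cong deriv-a-part (sym (mul-unfold a (deriv b) n)) ⟩
      mul (deriv a) b n + mul a (deriv b) n ∎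
      where
      open +-Solver
      shifted : ∀ n → shift (deriv (mul (tail a) b)) n ≈ shift (mul (deriv (tail a)) b) n + shift (mul (tail a) (deriv b)) n
      shifted zero    = sym (+-identityʳ _)
      shifted (suc n) = go n (tail a)
      deriv-a-part : mul (tail a) b n + shift (mul (deriv (tail a)) b) n ≈ mul (deriv a) b n
      deriv-a-part = sym (trans (mul-cong (deriv-head+shift-tail a) ≋-refl n)
                                (trans (mul-distribʳ _ _ b n) (+-congˡ (mul-shiftˡ _ b n))))

  pow-homo-+ : ∀ a i j → pow a (i ℕ.+ j) ≋ mul (pow a i) (pow a j)
  pow-homo-+ a zero j = ≋-sym (mul-identityˡ _)
  pow-homo-+ a (suc i) j = ≋-trans (mul-cong ≋-refl (pow-homo-+ a i j)) (≋-sym (mul-assoc a (pow a i) (pow a j)))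

  pow-suc-mulʳ : ∀ a j → pow a (suc j) ≋ mul (pow a j) a
  pow-suc-mulʳ a j = mul-comm a (pow a j)

  shiftBy-+ : ∀ p q u → shiftBy (p ℕ.+ q) u ≡ shiftBy p (shiftBy q u)
  shiftBy-+ zero q u = ≡.refl
  shiftBy-+ (suc p) q u = ≡.cong shift (shiftBy-+ p q u)

  shiftBy-cong : ∀ p {a b} → a ≋ b → shiftBy p a ≋ shiftBy p b
  shiftBy-cong zero e = e
  shiftBy-cong (suc p) e = shift-cong (shiftBy-cong p e)

  mul-shiftByˡ : ∀ p a b → mul (shiftBy p a) b ≋ shiftBy p (mul a b)
  mul-shiftByˡ zero a b = ≋-refl
  mul-shiftByˡ (suc p) a b = ≋-trans (mul-shiftˡ _ b) (shift-cong (mul-shiftByˡ p a b))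

  mul-shiftByʳ : ∀ p a b → mul a (shiftBy p b) ≋ shiftBy p (mul a b)
  mul-shiftByʳ p a b = ≋-trans (mul-comm a _) (≋-trans (mul-shiftByˡ p b a) (shiftBy-cong p (mul-comm b a)))

  shiftBy-below : ∀ p u n → n < p → shiftBy p u n ≈ 0#
  shiftBy-below (suc p) u zero n<p = refl
  shiftBy-below (suc p) u (suc n) (s≤s n<p) = shiftBy-below p u n n<p

  shiftBy-at : ∀ p u m → shiftBy p u (p ℕ.+ m) ≡ u m
  shiftBy-at zero u m = ≡.refl
  shiftBy-at (suc p) u m = shiftBy-at p u m

  shiftBy-above : ∀ p u n → p ≤ n → shiftBy p u n ≈ u (n ∸ p)
  shiftBy-above p u n p≤n = ≡⇒≈ (≡.trans (≡.cong (shiftBy p u) (≡.sym (ℕP.m+[n∸m]≡n p≤n))) (shiftBy-at p u (n ∸ p)))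

  pow-shiftBy : ∀ p u j → pow (shiftBy p u) j ≋ shiftBy (p ℕ.* j) (pow u j)
  pow-shiftBy p u zero n = ≡⇒≈ (≡.cong (λ z → shiftBy z 1ₛ n) (≡.sym (ℕP.*-zeroʳ p)))
  pow-shiftBy p u (suc j) n = begin
    mul (shiftBy p u) (pow (shiftBy p u) j) n              ≈⟨ mul-cong ≋-refl (pow-shiftBy p u j) n ⟩
    mul (shiftBy p u) (shiftBy (p ℕ.* j) (pow u j)) n      ≈⟨ mul-shiftByʳ (p ℕ.* j) _ _ n ⟩
    shiftBy (p ℕ.* j) (mul (shiftBy p u) (pow u j)) n      ≈⟨ shiftBy-cong (p ℕ.* j) (mul-shiftByˡ p u (pow u j)) n ⟩
    shiftBy (p ℕ.* j) (shiftBy p (pow u (suc j))) n        ≡⟨ ≡.cong (λ z → z n) (≡.sym (shiftBy-+ (p ℕ.* j) p (pow u (suc j)))) ⟩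
    shiftBy (p ℕ.* j ℕ.+ p) (pow u (suc j)) n              ≡⟨ ≡.cong (λ z → shiftBy z (pow u (suc j)) n)
                                                                     (≡.trans (ℕP.+-comm (p ℕ.* j) p) (≡.sym (ℕP.*-suc p j))) ⟩
    shiftBy (p ℕ.* suc j) (pow u (suc j)) n                ∎

  ≋shift-tail : ∀ u → u 0 ≈ 0# → u ≋ shift (tail u)
  ≋shift-tail u u₀≈0 zero = u₀≈0
  ≋shift-tail u u₀≈0 (suc n) = refl

  pow-below-order : ∀ u → u 0 ≈ 0# → ∀ j n → n < j → pow u j n ≈ 0#
  pow-below-order u u₀≈0 j n n<j = begin
    pow u j n                            ≈⟨ pow-cong j (≋shift-tail u u₀≈0) n ⟩
    pow (shiftBy 1 (tail u)) j n         ≈⟨ pow-shiftBy 1 (tail u) j n ⟩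
    shiftBy (1 ℕ.* j) (pow (tail u) j) n  ≈⟨ shiftBy-below (1 ℕ.* j) _ n (≡.subst (n <_) (≡.sym (ℕP.*-identityˡ j)) n<j) ⟩
    0#                                   ∎

  ≋-isEquivalence : IsEquivalence _≋_
  ≋-isEquivalence = record { refl = ≋-refl ; sym = ≋-sym ; trans = ≋-trans }

  seriesSemiring : CommutativeSemiring c ℓ
  seriesSemiring = record
    { Carrier = Series ; _≈_ = _≋_ ; _+_ = _+ₛ_ ; _*_ = mul ; 0# = 0ₛ ; 1# = 1ₛ
    ; isCommutativeSemiring = IsCommutativeSemiringˡ.isCommutativeSemiring (record
      { +-isCommutativeMonoid = record
        { isMonoid = record
          { isSemigroup = record
            { isMagma = record { isEquivalence = ≋-isEquivalence ; ∙-cong = +ₛ-cong }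
            ; assoc = λ a b d n → +-assoc _ _ _ }
          ; identity = (λ a n → +-identityˡ _) , (λ a n → +-identityʳ _) }
        ; comm = λ a b n → +-comm _ _ }
      ; *-isCommutativeMonoid = record
        { isMonoid = record
          { isSemigroup = record
            { isMagma = record { isEquivalence = ≋-isEquivalence ; ∙-cong = mul-cong }
            ; assoc = mul-assoc }
          ; identity = mul-identityˡ , mul-identityʳ }
        ; comm = mul-comm }
      ; distribʳ = λ d a b → mul-distribʳ a b d
      ; zeroˡ = mul-zeroˡ })
    }

  private
    open CommutativeSemiring seriesSemiring using () renaming (semiring to seriesSR)
    open RawMonoidDefs (Semiring.+-rawMonoid seriesSR) using (sum) renaming (_×_ to _×ₛ_)
    open RawMonoidDefs (Semiring.*-rawMonoid seriesSR) using () renaming (_×_ to _^ᴸ'_)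

    sum≋Σₛ : ∀ n (f : ℕ → Series) → sum {n} (f ∘ toℕ) ≋ Σₛ n f
    sum≋Σₛ zero    f = ≋-refl
    sum≋Σₛ (suc n) f = +ₛ-cong ≋-refl (sum≋Σₛ n (f ∘ suc))

    ×ₛ≋scale : ∀ m s → (m ×ₛ s) ≋ scale (fromℕ m) s
    ×ₛ≋scale zero    s n = sym (zeroˡ _)
    ×ₛ≋scale (suc m) s n = trans (+-cong (sym (*-identityˡ _)) (×ₛ≋scale m s n)) (sym (distribʳ _ _ _))

    ^ᴸ'≋pow : ∀ j a → (j ^ᴸ' a) ≋ pow a j
    ^ᴸ'≋pow zero    a = ≋-refl
    ^ᴸ'≋pow (suc j) a = mul-cong ≋-refl (^ᴸ'≋pow j a)

  pow-binomial : ∀ u v j →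
    pow (u +ₛ v) j ≋ Σₛ (suc j) (λ e → scale (fromℕ (j C e)) (mul (pow u e) (pow v (j ∸ e))))
  pow-binomial u v j =
    ≋-trans (≋-sym (^ᴸ'≋pow j (u +ₛ v))) (≋-trans (SemiringBinomial.theorem seriesSR u v (mul-comm u v) j)
    (≋-trans (sum≋Σₛ (suc j) (λ e → (j C e) ×ₛ mul (e ^ᴸ' u) ((j ∸ e) ^ᴸ' v)))
    (Σₛ-cong (suc j) (λ e _ → ≋-trans (×ₛ≋scale (j C e) _)
      (scale-cong refl (mul-cong (^ᴸ'≋pow e u) (^ᴸ'≋pow (j ∸ e) v)))))))

  pow-scale : ∀ x s e → pow (scale x s) e ≋ scale (x ^ e) (pow s e)
  pow-scale x s zero    n = sym (*-identityˡ _)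
  pow-scale x s (suc e) n = begin
    mul (scale x s) (pow (scale x s) e) n        ≈⟨ mul-cong ≋-refl (pow-scale x s e) n ⟩
    mul (scale x s) (scale (x ^ e) (pow s e)) n  ≈⟨ mul-scaleʳ (x ^ e) (scale x s) (pow s e) n ⟩
    x ^ e * mul (scale x s) (pow s e) n          ≈⟨ *-congˡ (mul-scaleˡ x s (pow s e) n) ⟩
    x ^ e * (x * mul s (pow s e) n)              ≈⟨ x*yz≈y*xz _ _ _ ⟩
    x * (x ^ e * mul s (pow s e) n)              ≈⟨ sym (*-assoc _ _ _) ⟩
    (x * x ^ e) * mul s (pow s e) n              ∎

  pow-1ₛ : ∀ e → pow 1ₛ e ≋ 1ₛ
  pow-1ₛ zero    = ≋-refl
  pow-1ₛ (suc e) = ≋-trans (mul-identityˡ _) (pow-1ₛ e)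

  ≡⇒≋ : ∀ {a b : Series} → a ≡ b → a ≋ b
  ≡⇒≋ ≡.refl = ≋-refl

  +ₛ-cancelʳ : ∀ {a b h : Series} → a +ₛ h ≋ b +ₛ h → a ≋ b
  +ₛ-cancelʳ {a} {b} {h} p n = begin
    a n                  ≈⟨ sym (+-identityʳ _) ⟩
    a n + 0#             ≈⟨ +-congˡ (sym (-‿inverseʳ (h n))) ⟩
    a n + (h n + - h n)  ≈⟨ sym (+-assoc _ _ _) ⟩
    (a n + h n) + - h n  ≈⟨ +-congʳ (p n) ⟩
    (b n + h n) + - h n  ≈⟨ +-assoc _ _ _ ⟩
    b n + (h n + - h n)  ≈⟨ +-congˡ (-‿inverseʳ (h n)) ⟩
    b n + 0#             ≈⟨ +-identityʳ _ ⟩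
    b n                  ∎

module BellPolynomials {c ℓ} (K : CharZeroField c ℓ) where

  open PowerSeries K public

  Σl-++ : ∀ {A : Set} (t : A → Carrier) xs ys → Σl (map t (xs ++ ys)) ≈ Σl (map t xs) + Σl (map t ys)
  Σl-++ t []       ys = sym (+-identityˡ _)
  Σl-++ t (x ∷ xs) ys = trans (+-congˡ (Σl-++ t xs ys)) (sym (+-assoc _ _ _))

  Σl-concatMap : ∀ {A B : Set} (t : B → Carrier) (g : A → List B) V →
    Σl (map t (concatMap g V)) ≈ Σl (map (λ v → Σl (map t (g v))) V)
  Σl-concatMap t g []      = refl
  Σl-concatMap t g (v ∷ V) = trans (Σl-++ t (g v) (concatMap g V)) (+-congˡ (Σl-concatMap t g V))

  Σl-map-map : ∀ {A B : Set} (t : B → Carrier) (h : A → B) L → Σl (map t (map h L)) ≡ Σl (map (t ∘ h) L)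
  Σl-map-map t h []      = ≡.refl
  Σl-map-map t h (x ∷ L) = ≡.cong₂ _+_ ≡.refl (Σl-map-map t h L)

  Σl-applyUpTo : ∀ (h : ℕ → Carrier) f n → Σl (map h (applyUpTo f n)) ≈ Σ n (h ∘ f)
  Σl-applyUpTo h f zero    = refl
  Σl-applyUpTo h f (suc n) = +-congˡ (Σl-applyUpTo h (f ∘ suc) n)

  Σl-cong : ∀ {A : Set} {t t' : A → Carrier} L → (∀ r → t r ≈ t' r) → Σl (map t L) ≈ Σl (map t' L)
  Σl-cong []      e = refl
  Σl-cong (x ∷ L) e = +-cong (e x) (Σl-cong L e)

  *-distribˡ-Σl : ∀ {A : Set} x (t : A → Carrier) L → x * Σl (map t L) ≈ Σl (map (λ r → x * t r) L)
  *-distribˡ-Σl x t []      = zeroʳ x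
  *-distribˡ-Σl x t (r ∷ L) = trans (distribˡ _ _ _) (+-congˡ (*-distribˡ-Σl x t L))

  Σl-Σ-comm : ∀ {A : Set} n (h : ℕ → A → Carrier) L →
    Σl (map (λ v → Σ n (λ e → h e v)) L) ≈ Σ n (λ e → Σl (map (h e) L))
  Σl-Σ-comm n h []      = sym (Σ-zero n _ (λ _ _ → refl))
  Σl-Σ-comm n h (v ∷ L) = trans (+-congˡ (Σl-Σ-comm n h L)) (sym (Σ-distrib-+ n (λ e → h e v) _))

  if-cong : ∀ (b : Bool) {x y} → x ≈ y → (if b then x else 0#) ≈ (if b then y else 0#)
  if-cong true  p = p
  if-cong false p = refl

  Σl-map-if : ∀ {A : Set} (b : Bool) k (t : A → Carrier) L →
    Σl (map (λ v → if b then k * t v else 0#) L) ≈ (if b then k * Σl (map t L) else 0#)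
  Σl-map-if true  k t L       = sym (*-distribˡ-Σl k t L)
  Σl-map-if false k t []      = refl
  Σl-map-if false k t (x ∷ L) = trans (+-identityˡ _) (Σl-map-if false k t L)

  ≤ᵇ-true : ∀ {m n} → m ≤ n → (m ≤ᵇ n) ≡ true
  ≤ᵇ-true {m} {n} = dec-true (m ≤? n)

  ≤ᵇ-false : ∀ {m n} → n < m → (m ≤ᵇ n) ≡ false
  ≤ᵇ-false {m} {n} n<m = dec-false (m ≤? n) (ℕP.<⇒≱ n<m)

  <ᵇ-true : ∀ {m n} → m < n → (m ℕ.<ᵇ n) ≡ true
  <ᵇ-true {m} {n} = dec-true (m <? n)

  <ᵇ-false : ∀ {m n} → n ≤ m → (m ℕ.<ᵇ n) ≡ false
  <ᵇ-false {m} {n} n≤m = dec-false (m <? n) (ℕP.≤⇒≯ n≤m)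

  +-≡ᵇ-cancelˡ : ∀ e s j → e ≤ j → (e ℕ.+ s ≡ᵇ j) ≡ (s ≡ᵇ j ∸ e)
  +-≡ᵇ-cancelˡ zero    s j       _         = ≡.refl
  +-≡ᵇ-cancelˡ (suc e) s (suc j) (s≤s e≤j) = +-≡ᵇ-cancelˡ e s j e≤j

  +-≡ᵇ-false : ∀ e s j → j < e → (e ℕ.+ s ≡ᵇ j) ≡ false
  +-≡ᵇ-false (suc e) s zero    _         = ≡.refl
  +-≡ᵇ-false (suc e) s (suc j) (s≤s j<e) = +-≡ᵇ-false e s j j<e

  Guards : Bool → Bool → Bool → Set
  Guards g b b′ = (g ≡ true × b ≡ b′) ⊎ (g ≡ false × b ≡ false)

  +-≡ᵇ-guarded : ∀ e s j → Guards (e ≤ᵇ j) (e ℕ.+ s ≡ᵇ j) (s ≡ᵇ j ∸ e)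
  +-≡ᵇ-guarded e s j with e ≤? j
  ... | yes e≤j = inj₁ (≤ᵇ-true e≤j , +-≡ᵇ-cancelˡ e s j e≤j)
  ... | no  e≰j = inj₂ (≤ᵇ-false (ℕP.≰⇒> e≰j) , +-≡ᵇ-false e s j (ℕP.≰⇒> e≰j))

  if-∧-guarded : ∀ {b₁ b₂ b₁′ b₂′ g₁ g₂ : Bool} {x y} k →
    Guards g₁ b₁ b₁′ → Guards g₂ b₂ b₂′ → x ≈ k * y →
    (if b₁ ∧ b₂ then x else 0#) ≈ (if g₁ ∧ g₂ then k * (if b₁′ ∧ b₂′ then y else 0#) else 0#)
  if-∧-guarded k (inj₂ (≡.refl , ≡.refl)) _ _ = refl
  if-∧-guarded {b₁ = b₁} k (inj₁ (≡.refl , ≡.refl)) (inj₂ (≡.refl , ≡.refl)) _ with b₁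
  ... | true  = refl
  ... | false = refl
  if-∧-guarded {b₁ = b₁} {b₂} k (inj₁ (≡.refl , ≡.refl)) (inj₁ (≡.refl , ≡.refl)) x≈ky with b₁ | b₂
  ... | true  | true  = x≈ky
  ... | true  | false = sym (zeroʳ k)
  ... | false | _     = sym (zeroʳ k)

  nCk*[k!*[n-k]!]≡n! : ∀ n k → k ≤ n → (n C k) ℕ.* (k ! ℕ.* (n ∸ k) !) ≡ n !
  nCk*[k!*[n-k]!]≡n! n k k≤n = ≡.trans (≡.cong (ℕ._* (k ! ℕ.* (n ∸ k) !)) (nCk≡n!/k![n-k]! k≤n))
    (m/n*n≡m {{ℕP._!*_!≢0 k (n ∸ k)}} (k![n∸k]!∣n! k≤n))

  n!⁻¹*nCk : ∀ n k → k ≤ n → (fromℕ (n !) ⁻¹) * fromℕ (n C k) ≈ (fromℕ (k !) ⁻¹) * (fromℕ ((n ∸ k) !) ⁻¹)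
  n!⁻¹*nCk n k k≤n = begin
    (fromℕ (n !) ⁻¹) * b               ≈⟨ *-congʳ (⁻¹-cong (n!≉0 n) (sym b*d≈n!)) ⟩
    ((b * d) ⁻¹) * b                   ≈⟨ *-congʳ (⁻¹-distrib-* b≉0 d≉0) ⟩
    ((b ⁻¹) * (d ⁻¹)) * b              ≈⟨ xy*z≈xz*y _ _ _ ⟩
    ((b ⁻¹) * b) * (d ⁻¹)              ≈⟨ *-congʳ (inverseˡ b b≉0) ⟩
    1# * (d ⁻¹)                        ≈⟨ *-identityˡ _ ⟩
    d ⁻¹                               ≈⟨ ⁻¹-distrib-* (n!≉0 k) (n!≉0 (n ∸ k)) ⟩
    (fromℕ (k !) ⁻¹) * (fromℕ ((n ∸ k) !) ⁻¹) ∎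
    where
    b : Carrier
    b = fromℕ (n C k)
    d : Carrier
    d = fromℕ (k !) * fromℕ ((n ∸ k) !)
    d≉0 : d ≉ 0#
    d≉0 = *-≉0 (n!≉0 k) (n!≉0 (n ∸ k))
    b*d≈n! : b * d ≈ fromℕ (n !)
    b*d≈n! = trans (*-congˡ (sym (fromℕ-* (k !) ((n ∸ k) !))))
             (trans (sym (fromℕ-* (n C k) _)) (≡⇒≈ (≡.cong fromℕ (nCk*[k!*[n-k]!]≡n! n k k≤n))))
    b≉0 : b ≉ 0#
    b≉0 b≈0 = n!≉0 n (trans (sym b*d≈n!) (trans (*-congʳ b≈0) (zeroˡ _)))

  denom-∷ : ∀ i e v → fromℕ (denom i (e ∷ v)) ≈ (fromℕ (e !) * fromℕ (i !) ^ e) * fromℕ (denom (suc i) v)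
  denom-∷ i e v = trans (fromℕ-* (e ! ℕ.* (i !) ℕ.^ e) (denom (suc i) v))
                    (*-congʳ (trans (fromℕ-* (e !) ((i !) ℕ.^ e)) (*-congˡ (fromℕ-^ (i !) e))))

  denom-≉0 : ∀ i r → fromℕ (denom i r) ≉ 0#
  denom-≉0 i []      = ≉0-resp-≈ (sym fromℕ-1) 1≉0
  denom-≉0 i (e ∷ r) = ≉0-resp-≈ (sym (denom-∷ i e r))
    (*-≉0 (*-≉0 (n!≉0 e) (^-≉0 e (n!≉0 i))) (denom-≉0 (suc i) r))

  denom-∷⁻¹ : ∀ i e v →
    fromℕ (denom i (e ∷ v)) ⁻¹ ≈ ((fromℕ (e !) ⁻¹) * (fromℕ (i !) ⁻¹) ^ e) * fromℕ (denom (suc i) v) ⁻¹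
  denom-∷⁻¹ i e v = begin
    fromℕ (denom i (e ∷ v)) ⁻¹                                         ≈⟨ ⁻¹-cong (denom-≉0 i (e ∷ v)) (denom-∷ i e v) ⟩
    ((fromℕ (e !) * fromℕ (i !) ^ e) * fromℕ (denom (suc i) v)) ⁻¹     ≈⟨ ⁻¹-distrib-* (*-≉0 (n!≉0 e) i!^e≉0) (denom-≉0 (suc i) v) ⟩
    (fromℕ (e !) * fromℕ (i !) ^ e) ⁻¹ * fromℕ (denom (suc i) v) ⁻¹    ≈⟨ *-congʳ (⁻¹-distrib-* (n!≉0 e) i!^e≉0) ⟩
    ((fromℕ (e !) ⁻¹) * (fromℕ (i !) ^ e) ⁻¹) * fromℕ (denom (suc i) v) ⁻¹ ≈⟨ *-congʳ (*-congˡ (^-⁻¹ e (n!≉0 i))) ⟩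
    ((fromℕ (e !) ⁻¹) * (fromℕ (i !) ⁻¹) ^ e) * fromℕ (denom (suc i) v) ⁻¹ ∎
    where
    i!^e≉0 : fromℕ (i !) ^ e ≉ 0#
    i!^e≉0 = ^-≉0 e (n!≉0 i)

  module BellSeries (X : ℕ → Carrier) where

    egf : Series
    egf zero    = 0#
    egf (suc s) = X (suc s) * (fromℕ (suc s !) ⁻¹)

    egfFrom : ℕ → Series
    egfFrom i = shiftBy i (λ s → egf (i ℕ.+ s))

    egfFrom-below : ∀ i n → n < i → egfFrom i n ≈ 0#
    egfFrom-below i n = shiftBy-below i _ n

    egfFrom-above : ∀ i n → i ≤ n → egfFrom i n ≈ egf n
    egfFrom-above i n i≤n = trans (shiftBy-above i _ n i≤n) (≡⇒≈ (≡.cong egf (ℕP.m+[n∸m]≡n i≤n)))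

    egfFrom-1 : egfFrom 1 ≋ egf
    egfFrom-1 zero    = refl
    egfFrom-1 (suc n) = refl

    egfFrom-peel : ∀ i → egfFrom i ≋ scale (egf i) (shiftBy i 1ₛ) +ₛ egfFrom (suc i)
    egfFrom-peel i n with ℕP.<-cmp n i
    ... | tri< n<i _ _ = sym (begin
      egf i * shiftBy i 1ₛ n + egfFrom (suc i) n
        ≈⟨ +-cong (*-congˡ (shiftBy-below i 1ₛ n n<i)) (egfFrom-below (suc i) n (ℕP.m<n⇒m<1+n n<i)) ⟩
      egf i * 0# + 0#
        ≈⟨ trans (+-identityʳ _) (zeroʳ _) ⟩
      0#
        ≈⟨ sym (egfFrom-below i n n<i) ⟩
      egfFrom i n                                 ∎)
    ... | tri≈ _ ≡.refl _ = sym (begin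
      egf n * shiftBy n 1ₛ n + egfFrom (suc n) n
        ≈⟨ +-cong (*-congˡ (shiftBy-above n 1ₛ n ℕP.≤-refl)) (egfFrom-below (suc n) n (ℕP.n<1+n n)) ⟩
      egf n * 1ₛ (n ∸ n) + 0#
        ≈⟨ +-identityʳ _ ⟩
      egf n * 1ₛ (n ∸ n)
        ≡⟨ ≡.cong (λ z → egf n * 1ₛ z) (ℕP.n∸n≡0 n) ⟩
      egf n * 1#
        ≈⟨ *-identityʳ _ ⟩
      egf n
        ≈⟨ sym (egfFrom-above n n ℕP.≤-refl) ⟩
      egfFrom n n                                 ∎)
    ... | tri> _ _ i<n = sym (begin
      egf i * shiftBy i 1ₛ n + egfFrom (suc i) n  ≈⟨ +-cong (*-congˡ (shiftBy-above i 1ₛ n (ℕP.<⇒≤ i<n))) (egfFrom-above (suc i) n i<n) ⟩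
      egf i * 1ₛ (n ∸ i) + egf n                  ≡⟨ ≡.cong (λ z → egf i * 1ₛ z + egf n) (ℕP.+-∸-assoc 1 i<n) ⟩
      egf i * 0# + egf n                          ≈⟨ trans (+-congʳ (zeroʳ _)) (+-identityˡ _) ⟩
      egf n                                       ≈⟨ sym (egfFrom-above i n (ℕP.<⇒≤ i<n)) ⟩
      egfFrom i n                                 ∎)

    -- The summand of bellSum at the multiplicities r = (r_i, r_{i+1}, …), without the factor m!.
    term : ℕ → ℕ → ℕ → List ℕ → Carrier
    term i m j r = if (sumℕ r ≡ᵇ j) ∧ (weight i r ≡ᵇ m) then (fromℕ (denom i r) ⁻¹) * monomial K X i r else 0#

    termSum : ℕ → ℕ → ℕ → ℕ → ℕ → Carrier
    termSum i l b m j = Σl (map (term i m j) (vecs l b))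

    powCoeff : ℕ → ℕ → ℕ → Carrier
    powCoeff i m j = (fromℕ (j !) ⁻¹) * pow (egfFrom i) j m

    expTerm : ℕ → ℕ → Carrier
    expTerm i e = (fromℕ (e !) ⁻¹) * (egf i ^ e)

    whenFits : ℕ → ℕ → ℕ → ℕ → Carrier → Carrier
    whenFits i m j e x = if (e ≤ᵇ j) ∧ (i ℕ.* e ≤ᵇ m) then x else 0#

    whenFits-cong : ∀ i m j e {x y} → x ≈ y → whenFits i m j e x ≈ whenFits i m j e y
    whenFits-cong i m j e = if-cong ((e ≤ᵇ j) ∧ (i ℕ.* e ≤ᵇ m))

    whenFits-> : ∀ i m j e x → j < e → whenFits i m j e x ≈ 0#
    whenFits-> i m j e x j<e rewrite ≤ᵇ-false j<e = refl

    whenFits-*> : ∀ i m j e x → m < i ℕ.* e → whenFits i m j e x ≈ 0#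
    whenFits-*> i m j e x m<ie rewrite ≤ᵇ-false m<ie with e ≤ᵇ j
    ... | true  = refl
    ... | false = refl

    term-∷ : ∀ i m j e v →
      term (suc i) m j (e ∷ v) ≈ whenFits (suc i) m j e (expTerm (suc i) e * term (suc (suc i)) (m ∸ (suc i ℕ.* e)) (j ∸ e) v)
    term-∷ i m j e v = if-∧-guarded (expTerm (suc i) e)
      (+-≡ᵇ-guarded e (sumℕ v) j) (+-≡ᵇ-guarded (suc i ℕ.* e) (weight (suc (suc i)) v) m) (begin
        fromℕ (denom (suc i) (e ∷ v)) ⁻¹ * (X (suc i) ^ e * mo)
          ≈⟨ *-congʳ (denom-∷⁻¹ (suc i) e v) ⟩
        (((fromℕ (e !) ⁻¹) * (f ⁻¹) ^ e) * (d ⁻¹)) * ((X (suc i) ^ e) * mo)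
          ≈⟨ *-Solver.solve 5 (λ a b c x y → ((a ⊕ b) ⊕ c) ⊕ (x ⊕ y) ⊜ (a ⊕ (x ⊕ b)) ⊕ (c ⊕ y)) refl _ _ _ _ _ ⟩
        ((fromℕ (e !) ⁻¹) * ((X (suc i) ^ e) * ((f ⁻¹) ^ e))) * ((d ⁻¹) * mo)
          ≈⟨ *-congʳ (*-congˡ (sym (^-distrib-* _ _ e))) ⟩
        expTerm (suc i) e * ((d ⁻¹) * mo)                                   ∎)
      where
      open *-Solver
      d f mo : Carrier
      d = fromℕ (denom (suc (suc i)) v)
      f = fromℕ (suc i !)
      mo = monomial K X (suc (suc i)) v

    powCoeff-binomial-term : ∀ i m j e → e ≤ j →
      (fromℕ (j !) ⁻¹) * (fromℕ (j C e) * mul (pow (scale (egf i) (shiftBy i 1ₛ)) e) (pow (egfFrom (suc i)) (j ∸ e)) m)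
        ≈ whenFits i m j e (expTerm i e * powCoeff (suc i) (m ∸ (i ℕ.* e)) (j ∸ e))
    powCoeff-binomial-term i m j e e≤j = begin
      (fromℕ (j !) ⁻¹) * (fromℕ (j C e) * mul (pow (scale α (shiftBy i 1ₛ)) e) Q m)
        ≈⟨ *-congˡ (*-congˡ (mul-cong (≋-trans (pow-scale α (shiftBy i 1ₛ) e)
             (scale-cong refl (≋-trans (pow-shiftBy i 1ₛ e) (shiftBy-cong (i ℕ.* e) (pow-1ₛ e))))) ≋-refl m)) ⟩
      (fromℕ (j !) ⁻¹) * (fromℕ (j C e) * mul (scale (α ^ e) (shiftBy (i ℕ.* e) 1ₛ)) Q m)
        ≈⟨ *-congˡ (*-congˡ (≋-trans (mul-scaleˡ _ _ Q)
             (scale-cong refl (≋-trans (mul-shiftByˡ (i ℕ.* e) 1ₛ Q) (shiftBy-cong (i ℕ.* e) (mul-identityˡ Q)))) m)) ⟩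
      (fromℕ (j !) ⁻¹) * (fromℕ (j C e) * ((α ^ e) * shiftBy (i ℕ.* e) Q m))  ≈⟨ sym (*-assoc _ _ _) ⟩
      ((fromℕ (j !) ⁻¹) * fromℕ (j C e)) * ((α ^ e) * shiftBy (i ℕ.* e) Q m)  ≈⟨ *-congʳ (n!⁻¹*nCk j e e≤j) ⟩
      ((fromℕ (e !) ⁻¹) * (fromℕ ((j ∸ e) !) ⁻¹)) * ((α ^ e) * shiftBy (i ℕ.* e) Q m)  ≈⟨ *-interchange _ _ _ _ ⟩
      expTerm i e * ((fromℕ ((j ∸ e) !) ⁻¹) * shiftBy (i ℕ.* e) Q m)         ≈⟨ fits (i ℕ.* e ≤? m) ⟩
      whenFits i m j e (expTerm i e * powCoeff (suc i) (m ∸ (i ℕ.* e)) (j ∸ e)) ∎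
      where
      α : Carrier
      α = egf i
      Q : Series
      Q = pow (egfFrom (suc i)) (j ∸ e)
      fits : Dec (i ℕ.* e ≤ m) → expTerm i e * ((fromℕ ((j ∸ e) !) ⁻¹) * shiftBy (i ℕ.* e) Q m)
                                  ≈ whenFits i m j e (expTerm i e * powCoeff (suc i) (m ∸ (i ℕ.* e)) (j ∸ e))
      fits (yes ie≤m) rewrite ≤ᵇ-true e≤j | ≤ᵇ-true ie≤m = *-congˡ (*-congˡ (shiftBy-above (i ℕ.* e) Q m ie≤m))
      fits (no  ie≰m) rewrite ≤ᵇ-true e≤j | ≤ᵇ-false (ℕP.≰⇒> ie≰m) =
        trans (*-congˡ (trans (*-congˡ (shiftBy-below (i ℕ.* e) Q m (ℕP.≰⇒> ie≰m))) (zeroʳ _))) (zeroʳ _)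

    -- Binomial expansion of egfFrom i = egf i · xⁱ + egfFrom (i+1), summed to b ≥ m.
    powCoeff-peel : ∀ i′ b m j → m ≤ b → let i = suc i′ in
      powCoeff i m j ≈ Σ (suc b) (λ e → whenFits i m j e (expTerm i e * powCoeff (suc i) (m ∸ (i ℕ.* e)) (j ∸ e)))
    powCoeff-peel i′ b m j m≤b = begin
      powCoeff i m j                                                 ≈⟨ *-congˡ (pow-cong j (egfFrom-peel i) m) ⟩
      (fromℕ (j !) ⁻¹) * pow (xⁱ +ₛ egfFrom (suc i)) j m               ≈⟨ *-congˡ (pow-binomial xⁱ (egfFrom (suc i)) j m) ⟩
      (fromℕ (j !) ⁻¹) * Σ (suc j) binomialTerm                      ≈⟨ *-distribˡ-Σ (suc j) (fromℕ (j !) ⁻¹) binomialTerm ⟩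
      Σ (suc j) (λ e → (fromℕ (j !) ⁻¹) * binomialTerm e)            ≈⟨ Σ-cong-< (suc j) (λ e e<1+j → powCoeff-binomial-term i m j e (ℕP.≤-pred e<1+j)) ⟩
      Σ (suc j) F                                                    ≈⟨ sym (Σ-truncate (suc j) (suc (j ℕ.+ b)) F (s≤s (ℕP.m≤m+n j b))
                                                                          (λ e j<e _ → whenFits-> i m j e _ j<e)) ⟩
      Σ (suc (j ℕ.+ b)) F                                            ≈⟨ Σ-truncate (suc b) (suc (j ℕ.+ b)) F (s≤s (ℕP.m≤n+m b j))
                                                                          (λ e b<e _ → whenFits-*> i m j e _ (m<ie b<e)) ⟩
      Σ (suc b) F                                                    ∎
      where
      i : ℕ
      i = suc i′
      xⁱ : Series
      xⁱ = scale (egf i) (shiftBy i 1ₛ)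
      binomialTerm : ℕ → Carrier
      binomialTerm e = fromℕ (j C e) * mul (pow xⁱ e) (pow (egfFrom (suc i)) (j ∸ e)) m
      F : ℕ → Carrier
      F e = whenFits i m j e (expTerm i e * powCoeff (suc i) (m ∸ (i ℕ.* e)) (j ∸ e))
      m<ie : ∀ {e} → b < e → m < i ℕ.* e
      m<ie {e} b<e = ℕP.<-≤-trans (ℕP.≤-<-trans m≤b b<e) (ℕP.m≤n*m e i)

    termSum≈powCoeff : ∀ l i b m j → m ≤ b → m < suc i ℕ.+ l → termSum (suc i) l b m j ≈ powCoeff (suc i) m j
    termSum≈powCoeff zero i b m j m≤b m<i+0 = base j m (≡.subst (m <_) (ℕP.+-identityʳ (suc i)) m<i+0)
      where
      base : ∀ j m → m < suc i → termSum (suc i) zero b m j ≈ powCoeff (suc i) m j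
      base zero    zero    _   = trans (+-identityʳ _) (*-congʳ refl)
      base zero    (suc m) _   = trans (+-identityʳ _) (sym (zeroʳ _))
      base (suc j) m       m<i = trans (+-identityʳ _) (sym (trans (*-congˡ (trans (pow-shiftBy (suc i) _ (suc j) m)
        (shiftBy-below (suc i ℕ.* suc j) _ m (ℕP.<-≤-trans m<i (ℕP.m≤m*n (suc i) (suc j)))))) (zeroʳ _)))
    termSum≈powCoeff (suc l) i b m j m≤b m<i+l = begin
      termSum (suc i) (suc l) b m j
        ≈⟨ Σl-concatMap (term (suc i) m j) (λ v → map (_∷ v) (upTo (suc b))) (vecs l b) ⟩
      Σl (map (λ v → Σl (map (term (suc i) m j) (map (_∷ v) (upTo (suc b))))) (vecs l b))
        ≈⟨ Σl-cong (vecs l b) (λ v → trans (≡⇒≈ (Σl-map-map (term (suc i) m j) (_∷ v) (upTo (suc b))))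
                                          (Σl-applyUpTo (λ e → term (suc i) m j (e ∷ v)) id (suc b))) ⟩
      Σl (map (λ v → Σ (suc b) (λ e → term (suc i) m j (e ∷ v))) (vecs l b))
        ≈⟨ Σl-cong (vecs l b) (λ v → Σ-cong (suc b) (λ e → term-∷ i m j e v)) ⟩
      Σl (map (λ v → Σ (suc b) (λ e → G e (term (suc (suc i)) (m′ e) (j ∸ e) v))) (vecs l b))
        ≈⟨ Σl-Σ-comm (suc b) (λ e v → G e (term (suc (suc i)) (m′ e) (j ∸ e) v)) (vecs l b) ⟩
      Σ (suc b) (λ e → Σl (map (λ v → G e (term (suc (suc i)) (m′ e) (j ∸ e) v)) (vecs l b)))
        ≈⟨ Σ-cong (suc b) (λ e → Σl-map-if ((e ≤ᵇ j) ∧ (suc i ℕ.* e ≤ᵇ m)) (expTerm (suc i) e) (term (suc (suc i)) (m′ e) (j ∸ e)) (vecs l b)) ⟩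
      Σ (suc b) (λ e → G e (termSum (suc (suc i)) l b (m′ e) (j ∸ e)))
        ≈⟨ Σ-cong (suc b) (λ e → whenFits-cong (suc i) m j e (*-congˡ {expTerm (suc i) e} (termSum≈powCoeff l (suc i) b (m′ e) (j ∸ e)
             (ℕP.≤-trans (ℕP.m∸n≤m m (suc i ℕ.* e)) m≤b)
             (ℕP.≤-<-trans (ℕP.m∸n≤m m (suc i ℕ.* e)) (≡.subst (m <_) (ℕP.+-suc (suc i) l) m<i+l))))) ⟩
      Σ (suc b) (λ e → G e (powCoeff (suc (suc i)) (m′ e) (j ∸ e)))
        ≈⟨ sym (powCoeff-peel i b m j m≤b) ⟩
      powCoeff (suc i) m j ∎
      where
      m′ : ℕ → ℕ
      m′ e = m ∸ (suc i ℕ.* e)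
      G : ℕ → Carrier → Carrier
      G e x = whenFits (suc i) m j e (expTerm (suc i) e * x)

    bellSum≈termSum : ∀ m j → bellSum K m j X ≈ fromℕ (m !) * termSum 1 m m m j
    bellSum≈termSum m j = trans (Σl-cong (vecs m m) pull) (sym (*-distribˡ-Σl (fromℕ (m !)) (term 1 m j) (vecs m m)))
      where
      pull : ∀ r → (if (sumℕ r ≡ᵇ j) ∧ (weight 1 r ≡ᵇ m) then (fromℕ (m !) * (fromℕ (denom 1 r) ⁻¹)) * monomial K X 1 r else 0#)
                 ≈ fromℕ (m !) * term 1 m j r
      pull r with (sumℕ r ≡ᵇ j) ∧ (weight 1 r ≡ᵇ m)
      ... | true  = *-assoc _ _ _
      ... | false = sym (zeroʳ _)

    B≈coeff-pow : ∀ m j → B K m j X ≈ fromℕ (m !) * ((fromℕ (j !) ⁻¹) * pow egf j m)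
    B≈coeff-pow zero    zero    = sym (trans (*-congˡ (*-identityʳ _)) (inverseʳ _ (n!≉0 0)))
    B≈coeff-pow (suc m) zero    = sym (trans (*-congˡ (zeroʳ _)) (zeroʳ _))
    B≈coeff-pow zero    (suc j) = sym (trans (*-congˡ (trans (*-congˡ (pow-below-order egf refl (suc j) 0 (s≤s z≤n))) (zeroʳ _))) (zeroʳ _))
    B≈coeff-pow (suc m) (suc j) with m <? j
    ... | yes m<j rewrite <ᵇ-true m<j =
      sym (trans (*-congˡ (trans (*-congˡ (pow-below-order egf refl (suc j) (suc m) (s≤s m<j))) (zeroʳ _))) (zeroʳ _))
    ... | no  m≮j rewrite <ᵇ-false (ℕP.≮⇒≥ m≮j) = begin
      bellSum K (suc m) (suc j) X
        ≈⟨ bellSum≈termSum (suc m) (suc j) ⟩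
      fromℕ (suc m !) * termSum 1 (suc m) (suc m) (suc m) (suc j)
        ≈⟨ *-congˡ (termSum≈powCoeff (suc m) 0 (suc m) (suc m) (suc j) ℕP.≤-refl (ℕP.n<1+n (suc m))) ⟩
      fromℕ (suc m !) * powCoeff 1 (suc m) (suc j)
        ≈⟨ *-congˡ (*-congˡ (pow-cong (suc j) egfFrom-1 (suc m))) ⟩
      fromℕ (suc m !) * ((fromℕ (suc j !) ⁻¹) * pow egf (suc j) (suc m)) ∎

module IntegerPowers {c ℓ} (K : CharZeroField c ℓ) where

  open BellPolynomials K public

  infixr 8 _^ᶻ_
  _^ᶻ_ : Carrier → ℤ → Carrier
  x ^ᶻ r = _^ℤ_ K x r

  ^ᶻ-suc : ∀ {x} → x ≉ 0# → ∀ s → x ^ᶻ (s ℤ.+ + 1) ≈ (x ^ᶻ s) * x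
  ^ᶻ-suc {x} x≉0 (+ n)        = trans (≡⇒≈ (≡.cong (x ^_) (ℕP.+-comm n 1))) (*-comm _ _)
  ^ᶻ-suc {x} x≉0 -[1+ zero ]  = sym (trans (*-congʳ (*-identityʳ _)) (inverseˡ x x≉0))
  ^ᶻ-suc {x} x≉0 -[1+ suc n ] = sym (begin
    ((x ⁻¹) * ((x ⁻¹) * ((x ⁻¹) ^ n))) * x  ≈⟨ xy*z≈xz*y _ _ _ ⟩
    ((x ⁻¹) * x) * ((x ⁻¹) * ((x ⁻¹) ^ n))  ≈⟨ *-congʳ (inverseˡ x x≉0) ⟩
    1# * ((x ⁻¹) * ((x ⁻¹) ^ n))            ≈⟨ *-identityˡ _ ⟩
    (x ⁻¹) * ((x ⁻¹) ^ n)                   ∎)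

  falling-suc : ∀ r j → falling K (r ℤ.+ + 1) (suc j) ≡ (r ℤ.+ + 1) ℤ.* falling K r j
  falling-suc r zero    = lemma r
    where
    lemma : ∀ r → + 1 ℤ.* (r ℤ.+ + 1 ℤ.- + 0) ≡ (r ℤ.+ + 1) ℤ.* + 1
    lemma = solve-∀
  falling-suc r (suc j) = ≡.trans
    (≡.cong₂ (λ a b → a ℤ.* (r ℤ.+ + 1 ℤ.- b)) (falling-suc r j) (+[1+n]≡+n+1 j))
    (lemma r (falling K r j) (+ j))
    where
    lemma : ∀ r f j → ((r ℤ.+ + 1) ℤ.* f) ℤ.* (r ℤ.+ + 1 ℤ.- (j ℤ.+ + 1)) ≡ (r ℤ.+ + 1) ℤ.* (f ℤ.* (r ℤ.- j))
    lemma = solve-∀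

  falling-pascal : ∀ r j → falling K (r ℤ.+ + 1) (suc j) ≡ falling K r (suc j) ℤ.+ + suc j ℤ.* falling K r j
  falling-pascal r j = ≡.trans (falling-suc r j) (≡.trans (lemma r (falling K r j) (+ j))
    (≡.cong (λ z → falling K r j ℤ.* (r ℤ.- + j) ℤ.+ z ℤ.* falling K r j) (≡.sym (+[1+n]≡+n+1 j))))
    where
    lemma : ∀ r f j → (r ℤ.+ + 1) ℤ.* f ≡ f ℤ.* (r ℤ.- j) ℤ.+ (j ℤ.+ + 1) ℤ.* f
    lemma = solve-∀

  falling-0-suc : ∀ j → falling K (+ 0) (suc j) ≡ + 0
  falling-0-suc zero    = ≡.refl
  falling-0-suc (suc j) = ≡.trans (≡.cong (ℤ._* (+ 0 ℤ.- + suc j)) (falling-0-suc j)) (ℤP.*-zeroˡ (+ 0 ℤ.- + suc j))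

  -- Fʳ := Σ_j (r choose j) F₀^{r−j} F₊ʲ, the binomial series of (F₀ + F₊)ʳ,
  -- where F₊ is F without its constant term.
  module Powers (F : Series) (F₀≉0 : F 0 ≉ 0#) where

    F₀ : Carrier
    F₀ = F 0

    F₊ : Series
    F₊ zero    = 0#
    F₊ (suc n) = F (suc n)

    F≋F₀+F₊ : F ≋ scale F₀ 1ₛ +ₛ F₊
    F≋F₀+F₊ zero    = sym (trans (+-identityʳ _) (*-identityʳ _))
    F≋F₀+F₊ (suc n) = sym (trans (+-congʳ (zeroʳ _)) (+-identityˡ _))

    coeff : ℤ → ℕ → Carrier
    coeff r j = (fromℤ (falling K r j) * (F₀ ^ᶻ (r ℤ.- + j))) * (fromℕ (j !) ⁻¹)

    power : ℤ → Series
    power r n = Σ (suc n) (λ j → coeff r j * pow F₊ j n)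

    power≈truncated : ∀ M r n → n ≤ M → power r n ≈ Σₛ (suc M) (λ j → scale (coeff r j) (pow F₊ j)) n
    power≈truncated M r n n≤M = sym (Σ-truncate (suc n) (suc M) (λ j → coeff r j * pow F₊ j n) (s≤s n≤M)
      (λ j n<j _ → trans (*-congˡ (pow-below-order F₊ refl j n n<j)) (zeroʳ _)))

    coeff-suc-0 : ∀ r → coeff (r ℤ.+ + 1) 0 ≈ coeff r 0 * F₀
    coeff-suc-0 r = begin
      (fromℤ (+ 1) * (F₀ ^ᶻ (r ℤ.+ + 1 ℤ.- + 0))) * (fromℕ 1 ⁻¹)
        ≈⟨ *-congʳ (*-congˡ (≡⇒≈ (≡.cong (F₀ ^ᶻ_) (ℤP.+-identityʳ (r ℤ.+ + 1))))) ⟩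
      (fromℤ (+ 1) * (F₀ ^ᶻ (r ℤ.+ + 1))) * (fromℕ 1 ⁻¹)
        ≈⟨ *-congʳ (*-congˡ (^ᶻ-suc F₀≉0 r)) ⟩
      (fromℤ (+ 1) * ((F₀ ^ᶻ r) * F₀)) * (fromℕ 1 ⁻¹)
        ≈⟨ *-congʳ (*-congˡ (*-congʳ (≡⇒≈ (≡.cong (F₀ ^ᶻ_) (≡.sym (ℤP.+-identityʳ r)))))) ⟩
      (fromℤ (+ 1) * ((F₀ ^ᶻ (r ℤ.- + 0)) * F₀)) * (fromℕ 1 ⁻¹)
        ≈⟨ *-Solver.solve 4 (λ a b y z → (a ⊕ (b ⊕ y)) ⊕ z ⊜ ((a ⊕ b) ⊕ z) ⊕ y) refl _ _ _ _ ⟩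
      coeff r 0 * F₀                                              ∎
      where open *-Solver

    coeff-pascal : ∀ r j → coeff (r ℤ.+ + 1) (suc j) ≈ coeff r (suc j) * F₀ + coeff r j
    coeff-pascal r j = begin
      (fromℤ (falling K (r ℤ.+ + 1) (suc j)) * (F₀ ^ᶻ (r ℤ.+ + 1 ℤ.- + suc j))) * (fromℕ (suc j !) ⁻¹)
        ≈⟨ *-cong (*-cong falling≈ (≡⇒≈ (≡.cong (F₀ ^ᶻ_) exponent≡))) ([1+n]!⁻¹ j) ⟩
      ((fromℤ (falling K r (suc j)) + fromℕ (suc j) * fromℤ (falling K r j)) * pw) * ((fromℕ (suc j) ⁻¹) * (fromℕ (j !) ⁻¹))
        ≈⟨ trans (*-congʳ (distribʳ _ _ _)) (distribʳ _ _ _) ⟩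
      (fromℤ (falling K r (suc j)) * pw) * ((fromℕ (suc j) ⁻¹) * (fromℕ (j !) ⁻¹))
        + ((fromℕ (suc j) * fromℤ (falling K r j)) * pw) * ((fromℕ (suc j) ⁻¹) * (fromℕ (j !) ⁻¹))
        ≈⟨ +-cong first second ⟩
      coeff r (suc j) * F₀ + coeff r j ∎
      where
      open *-Solver
      pw : Carrier
      pw = F₀ ^ᶻ (r ℤ.- + j)
      falling≈ : fromℤ (falling K (r ℤ.+ + 1) (suc j)) ≈ fromℤ (falling K r (suc j)) + fromℕ (suc j) * fromℤ (falling K r j)
      falling≈ = trans (≡⇒≈ (≡.cong fromℤ (falling-pascal r j)))
        (trans (fromℤ-+ (falling K r (suc j)) (+ suc j ℤ.* falling K r j)) (+-congˡ (fromℤ-+ℕ*ℤ (suc j) (falling K r j))))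
      exponent≡ : r ℤ.+ + 1 ℤ.- + suc j ≡ r ℤ.- + j
      exponent≡ = ≡.trans (≡.cong (λ z → r ℤ.+ + 1 ℤ.- z) (+[1+n]≡+n+1 j)) (lemma r (+ j))
        where
        lemma : ∀ r j → r ℤ.+ + 1 ℤ.- (j ℤ.+ + 1) ≡ r ℤ.- j
        lemma = solve-∀
      pw≈ : pw ≈ (F₀ ^ᶻ (r ℤ.- + suc j)) * F₀
      pw≈ = trans (≡⇒≈ (≡.cong (F₀ ^ᶻ_) (≡.trans (lemma r (+ j)) (≡.cong (λ z → r ℤ.- z ℤ.+ + 1) (≡.sym (+[1+n]≡+n+1 j))))))
                  (^ᶻ-suc F₀≉0 (r ℤ.- + suc j))
        where
        lemma : ∀ r j → r ℤ.- j ≡ r ℤ.- (j ℤ.+ + 1) ℤ.+ + 1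
        lemma = solve-∀
      first : (fromℤ (falling K r (suc j)) * pw) * ((fromℕ (suc j) ⁻¹) * (fromℕ (j !) ⁻¹)) ≈ coeff r (suc j) * F₀
      first = begin
        (fromℤ (falling K r (suc j)) * pw) * ((fromℕ (suc j) ⁻¹) * (fromℕ (j !) ⁻¹))
          ≈⟨ *-cong (*-congˡ pw≈) (sym ([1+n]!⁻¹ j)) ⟩
        (fromℤ (falling K r (suc j)) * ((F₀ ^ᶻ (r ℤ.- + suc j)) * F₀)) * (fromℕ (suc j !) ⁻¹)
          ≈⟨ *-Solver.solve 4 (λ a b y z → (a ⊕ (b ⊕ y)) ⊕ z ⊜ ((a ⊕ b) ⊕ z) ⊕ y) refl _ _ _ _ ⟩
        coeff r (suc j) * F₀ ∎
      second : ((fromℕ (suc j) * fromℤ (falling K r j)) * pw) * ((fromℕ (suc j) ⁻¹) * (fromℕ (j !) ⁻¹)) ≈ coeff r j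
      second = begin
        ((fromℕ (suc j) * fromℤ (falling K r j)) * pw) * ((fromℕ (suc j) ⁻¹) * (fromℕ (j !) ⁻¹))
          ≈⟨ *-Solver.solve 5 (λ a b y z w → ((a ⊕ b) ⊕ y) ⊕ (z ⊕ w) ⊜ (a ⊕ z) ⊕ ((b ⊕ y) ⊕ w)) refl _ _ _ _ _ ⟩
        (fromℕ (suc j) * (fromℕ (suc j) ⁻¹)) * coeff r j ≈⟨ *-congʳ (inverseʳ _ (charZero j)) ⟩
        1# * coeff r j                                   ≈⟨ *-identityˡ _ ⟩
        coeff r j                                        ∎

    power-zero : power (+ 0) ≋ 1ₛ
    power-zero n = trans (+-cong (*-congʳ coeff-0-0) (Σ-zero n _ (λ j _ → coeff-0-suc j)))
                         (trans (+-identityʳ _) (*-identityˡ _))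
      where
      coeff-0-suc : ∀ j → coeff (+ 0) (suc j) * pow F₊ (suc j) n ≈ 0#
      coeff-0-suc j = trans (*-congʳ (trans (*-congʳ (trans (*-congʳ (≡⇒≈ (≡.cong fromℤ (falling-0-suc j)))) (zeroˡ _))) (zeroˡ _))) (zeroˡ _)
      coeff-0-0 : coeff (+ 0) 0 ≈ 1#
      coeff-0-0 = trans (*-cong (trans (*-congʳ fromℕ-1) (*-identityˡ _)) (trans (⁻¹-cong (n!≉0 0) fromℕ-1) 1⁻¹≈1)) (*-identityʳ _)

    scaled-pow*F : ∀ r j n →
      mul (scale (coeff r j) (pow F₊ j)) (scale F₀ 1ₛ +ₛ F₊) n ≈ coeff r j * F₀ * pow F₊ j n + coeff r j * pow F₊ (suc j) n
    scaled-pow*F r j n = begin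
      mul (scale (coeff r j) (pow F₊ j)) (scale F₀ 1ₛ +ₛ F₊) n       ≈⟨ mul-scaleˡ _ _ _ n ⟩
      coeff r j * mul (pow F₊ j) (scale F₀ 1ₛ +ₛ F₊) n               ≈⟨ *-congˡ (mul-distribˡ _ _ _ n) ⟩
      coeff r j * (mul (pow F₊ j) (scale F₀ 1ₛ) n + mul (pow F₊ j) F₊ n)
        ≈⟨ *-congˡ (+-cong (trans (mul-scaleʳ _ _ _ n) (*-congˡ (mul-identityʳ _ n))) (sym (pow-suc-mulʳ F₊ j n))) ⟩
      coeff r j * (F₀ * pow F₊ j n + pow F₊ (suc j) n)               ≈⟨ trans (distribˡ _ _ _) (+-congʳ (sym (*-assoc _ _ _))) ⟩
      coeff r j * F₀ * pow F₊ j n + coeff r j * pow F₊ (suc j) n     ∎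

    power-suc : ∀ r → power (r ℤ.+ + 1) ≋ mul (power r) F
    power-suc r n = sym (begin
      mul (power r) F n
        ≈⟨ mul-cong-≤ n (λ i i≤n → power≈truncated n r i i≤n) (λ i _ → F≋F₀+F₊ i) ⟩
      mul (Σₛ (suc n) (λ j → scale (coeff r j) (pow F₊ j))) (scale F₀ 1ₛ +ₛ F₊) n
        ≈⟨ mul-Σₛˡ (suc n) (scale F₀ 1ₛ +ₛ F₊) (λ j → scale (coeff r j) (pow F₊ j)) n ⟩
      Σ (suc n) (λ j → mul (scale (coeff r j) (pow F₊ j)) (scale F₀ 1ₛ +ₛ F₊) n)
        ≈⟨ Σ-cong (suc n) (λ j → scaled-pow*F r j n) ⟩
      Σ (suc n) (λ j → a j + b j)
        ≈⟨ Σ-distrib-+ (suc n) a b ⟩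
      Σ (suc n) a + Σ (suc n) b
        ≈⟨ +-congˡ (Σ-init-last n b) ⟩
      Σ (suc n) a + (Σ n b + b n)
        ≈⟨ +-congˡ (trans (+-congˡ (trans (*-congˡ (pow-below-order F₊ refl (suc n) n (ℕP.n<1+n n))) (zeroʳ _))) (+-identityʳ _)) ⟩
      (a 0 + Σ n (a ∘ suc)) + Σ n b
        ≈⟨ +-assoc _ _ _ ⟩
      a 0 + (Σ n (a ∘ suc) + Σ n b)
        ≈⟨ +-congˡ (sym (Σ-distrib-+ n (a ∘ suc) b)) ⟩
      a 0 + Σ n (λ j → a (suc j) + b j)
        ≈⟨ +-cong (*-congʳ (sym (coeff-suc-0 r)))
                  (Σ-cong n (λ j → trans (sym (distribʳ _ _ _)) (*-congʳ (sym (coeff-pascal r j))))) ⟩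
      power (r ℤ.+ + 1) n ∎)
      where
      a b : ℕ → Carrier
      a j = coeff r j * F₀ * pow F₊ j n
      b j = coeff r j * pow F₊ (suc j) n

    power-inverse : mul (power -[1+ 0 ]) F ≋ 1ₛ
    power-inverse = ≋-trans (≋-sym (power-suc -[1+ 0 ])) power-zero

    mul-cancelʳ-F : ∀ {a b} → mul a F ≋ mul b F → a ≋ b
    mul-cancelʳ-F {a} {b} aF≋bF n = begin
      a n                ≈⟨ sym (mul-identityʳ a n) ⟩
      mul a 1ₛ n         ≈⟨ mul-cong ≋-refl (≋-trans (≋-sym power-inverse) (mul-comm _ F)) n ⟩
      mul a (mul F G) n  ≈⟨ sym (mul-assoc a F G n) ⟩
      mul (mul a F) G n  ≈⟨ mul-cong aF≋bF ≋-refl n ⟩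
      mul (mul b F) G n  ≈⟨ mul-assoc b F G n ⟩
      mul b (mul F G) n  ≈⟨ mul-cong ≋-refl (≋-trans (mul-comm F G) power-inverse) n ⟩
      mul b 1ₛ n         ≈⟨ mul-identityʳ b n ⟩
      b n                ∎
      where
      G : Series
      G = power -[1+ 0 ]

    -- Multiplication by F is invertible, so a solution of this recurrence in r
    -- is determined by its value at 0 in both directions.
    recurrence-unique : (Φ Ψ H : ℤ → Series) → Φ (+ 0) ≋ Ψ (+ 0) →
      (∀ r → Φ (r ℤ.+ + 1) ≋ mul (Φ r) F +ₛ H r) → (∀ r → Ψ (r ℤ.+ + 1) ≋ mul (Ψ r) F +ₛ H r) →
      ∀ r → Φ r ≋ Ψ r
    recurrence-unique Φ Ψ H Φ₀≋Ψ₀ Φ-suc Ψ-suc = ℤ-induction (λ r → Φ r ≋ Ψ r) Φ₀≋Ψ₀ up down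
      where
      up : ∀ r → Φ r ≋ Ψ r → Φ (r ℤ.+ + 1) ≋ Ψ (r ℤ.+ + 1)
      up r Φr≋Ψr = ≋-trans (Φ-suc r) (≋-trans (+ₛ-cong (mul-cong Φr≋Ψr ≋-refl) ≋-refl) (≋-sym (Ψ-suc r)))
      down : ∀ r → Φ r ≋ Ψ r → Φ (r ℤ.- + 1) ≋ Ψ (r ℤ.- + 1)
      down r Φr≋Ψr = mul-cancelʳ-F (+ₛ-cancelʳ (≋-trans (≋-sym (Φ-suc (r ℤ.- + 1)))
        (≋-trans (≡⇒≋ (≡.cong Φ (i-1+1≡i r))) (≋-trans Φr≋Ψr
        (≋-trans (≡⇒≋ (≡.cong Ψ (≡.sym (i-1+1≡i r)))) (Ψ-suc (r ℤ.- + 1)))))))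

    power-+ℕ : ∀ m → power (+ m) ≋ pow F m
    power-+ℕ zero    = power-zero
    power-+ℕ (suc m) = ≋-trans (≡⇒≋ (≡.cong power (+[1+n]≡+n+1 m)))
      (≋-trans (power-suc (+ m)) (≋-trans (mul-cong (power-+ℕ m) ≋-refl) (mul-comm _ F)))

    power-homo-+ : ∀ r s → power (r ℤ.+ s) ≋ mul (power r) (power s)
    power-homo-+ r s = recurrence-unique (λ r → power (r ℤ.+ s)) (λ r → mul (power r) (power s)) (λ _ → 0ₛ)
      (≋-trans (≡⇒≋ (≡.cong power (ℤP.+-identityˡ s))) (≋-sym (≋-trans (mul-cong power-zero ≋-refl) (mul-identityˡ _))))
      (λ r → ≋-trans (≡⇒≋ (≡.cong power (lemma r s))) (≋-trans (power-suc (r ℤ.+ s)) (λ n → sym (+-identityʳ _))))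
      (λ r → ≋-trans (mul-cong (power-suc r) ≋-refl) (≋-trans (mul-assoc _ _ _) (≋-trans (mul-cong ≋-refl (mul-comm F _))
        (≋-trans (≋-sym (mul-assoc _ _ _)) (λ n → sym (+-identityʳ _)))))) r
      where
      lemma : ∀ r s → r ℤ.+ + 1 ℤ.+ s ≡ r ℤ.+ s ℤ.+ + 1
      lemma = solve-∀

    deriv-power : ∀ r → deriv (power r) ≋ scale (fromℤ r) (mul (power (r ℤ.- + 1)) (deriv F))
    deriv-power = recurrence-unique (λ r → deriv (power r)) rhs (λ r → mul (power r) (deriv F))
      (≋-trans (deriv-cong power-zero) (≋-trans deriv-1ₛ (λ n → sym (zeroˡ _))))
      (λ r → ≋-trans (deriv-cong (power-suc r)) (deriv-mul (power r) F))
      (λ r → ≋-trans (scale-cong (fromℤ-suc r) (mul-cong (≡⇒≋ (≡.cong power (lemma r))) ≋-refl)) (≋-sym (rhs-suc r)))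
      where
      rhs : ℤ → Series
      rhs r = scale (fromℤ r) (mul (power (r ℤ.- + 1)) (deriv F))
      lemma : ∀ r → r ℤ.+ + 1 ℤ.- + 1 ≡ r
      lemma = solve-∀
      rhs-suc : ∀ r → mul (rhs r) F +ₛ mul (power r) (deriv F) ≋ scale (fromℤ r + 1#) (mul (power r) (deriv F))
      rhs-suc r n = begin
        mul (rhs r) F n + P n                        ≈⟨ +-congʳ (trans (mul-scaleˡ _ _ F n) (*-congˡ rearrange)) ⟩
        fromℤ r * P n + P n                          ≈⟨ +-congˡ (sym (*-identityˡ _)) ⟩
        fromℤ r * P n + 1# * P n                     ≈⟨ sym (distribʳ _ _ _) ⟩
        (fromℤ r + 1#) * P n                         ∎
        where
        P : Series
        P = mul (power r) (deriv F)
        rearrange : mul (mul (power (r ℤ.- + 1)) (deriv F)) F n ≈ P n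
        rearrange = begin
          mul (mul (power (r ℤ.- + 1)) (deriv F)) F n
            ≈⟨ mul-assoc _ _ _ n ⟩
          mul (power (r ℤ.- + 1)) (mul (deriv F) F) n
            ≈⟨ mul-cong ≋-refl (mul-comm (deriv F) F) n ⟩
          mul (power (r ℤ.- + 1)) (mul F (deriv F)) n
            ≈⟨ sym (mul-assoc _ _ _ n) ⟩
          mul (mul (power (r ℤ.- + 1)) F) (deriv F) n
            ≈⟨ mul-cong (≋-trans (≋-sym (power-suc (r ℤ.- + 1))) (≡⇒≋ (≡.cong power (i-1+1≡i r)))) ≋-refl n ⟩
          P n                                          ∎

  expSeries : (ℕ → Carrier) → Series
  expSeries Z zero    = Z 0
  expSeries Z (suc i) = Z (suc i) * (fromℕ (suc i !) ⁻¹)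

  Phat≈coeff-power : ∀ (Z : ℕ → Carrier) (Z₀≉0 : Z 0 ≉ 0#) m r →
    Phat K m r Z ≈ fromℕ (m !) * Powers.power (expSeries Z) Z₀≉0 r m
  Phat≈coeff-power Z Z₀≉0 m r = begin
    Phat K m r Z
      ≡⟨ sumRange≡Σ 0 (suc m) _ ⟩
    Σ (suc m) (λ j → (fromℤ (falling K r j) * (Z 0 ^ᶻ (r ℤ.- + j))) * B K m j Z)
      ≈⟨ Σ-cong (suc m) term≈ ⟩
    Σ (suc m) (λ j → fromℕ (m !) * (coeff r j * pow F₊ j m))
      ≈⟨ sym (*-distribˡ-Σ (suc m) (fromℕ (m !)) (λ j → coeff r j * pow F₊ j m)) ⟩
    fromℕ (m !) * power r m                                         ∎
    where
    open Powers (expSeries Z) Z₀≉0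
    egf≋F₊ : BellSeries.egf Z ≋ F₊
    egf≋F₊ zero    = refl
    egf≋F₊ (suc n) = refl
    term≈ : ∀ j → (fromℤ (falling K r j) * (Z 0 ^ᶻ (r ℤ.- + j))) * B K m j Z ≈ fromℕ (m !) * (coeff r j * pow F₊ j m)
    term≈ j = begin
      (fromℤ (falling K r j) * (Z 0 ^ᶻ (r ℤ.- + j))) * B K m j Z
        ≈⟨ *-congˡ (BellSeries.B≈coeff-pow Z m j) ⟩
      (fromℤ (falling K r j) * (Z 0 ^ᶻ (r ℤ.- + j))) * (fromℕ (m !) * ((fromℕ (j !) ⁻¹) * pow (BellSeries.egf Z) j m))
        ≈⟨ *-congˡ (*-congˡ (*-congˡ (pow-cong j egf≋F₊ m))) ⟩
      (fromℤ (falling K r j) * (Z 0 ^ᶻ (r ℤ.- + j))) * (fromℕ (m !) * ((fromℕ (j !) ⁻¹) * pow F₊ j m))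
        ≈⟨ *-Solver.solve 4 (λ x y z w → x ⊕ (y ⊕ (z ⊕ w)) ⊜ y ⊕ ((x ⊕ z) ⊕ w)) refl _ _ _ _ ⟩
      fromℕ (m !) * (coeff r j * pow F₊ j m) ∎
      where open *-Solver

module LagrangeInversion {c ℓ} (K : CharZeroField c ℓ) where

  open IntegerPowers K public

  compose : Series → Series → Series
  compose P a n = Σ (suc n) (λ i → P i * pow a i n)

  mul-cong-< : ∀ {a} → a 0 ≈ 0# → ∀ n {u v} → (∀ i → i < n → u i ≈ v i) → mul a u n ≈ mul a v n
  mul-cong-< {a} a₀≈0 n {u} {v} u≈v = begin
    mul a u n                    ≈⟨ mul-cong (≋shift-tail a a₀≈0) ≋-refl n ⟩
    mul (shift (tail a)) u n     ≈⟨ mul-shiftˡ (tail a) u n ⟩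
    shift (mul (tail a) u) n     ≈⟨ shifted n u≈v ⟩
    shift (mul (tail a) v) n     ≈⟨ sym (mul-shiftˡ (tail a) v n) ⟩
    mul (shift (tail a)) v n     ≈⟨ sym (mul-cong (≋shift-tail a a₀≈0) ≋-refl n) ⟩
    mul a v n                    ∎
    where
    shifted : ∀ n → (∀ i → i < n → u i ≈ v i) → shift (mul (tail a) u) n ≈ shift (mul (tail a) v) n
    shifted zero    _   = refl
    shifted (suc n) u≈v = mul-cong-≤ n (λ _ _ → refl) (λ i i≤n → u≈v i (s≤s i≤n))

  module Composition (a : Series) (a₀≈0 : a 0 ≈ 0#) where

    compose-truncate : ∀ P M n → n ≤ M → compose P a n ≈ Σₛ (suc M) (λ i → scale (P i) (pow a i)) n
    compose-truncate P M n n≤M = sym (Σ-truncate (suc n) (suc M) (λ i → P i * pow a i n) (s≤s n≤M)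
      (λ i n<i _ → trans (*-congˡ (pow-below-order a a₀≈0 i n n<i)) (zeroʳ _)))

    compose-congˡ : ∀ {P Q} → P ≋ Q → compose P a ≋ compose Q a
    compose-congˡ P≋Q n = Σ-cong (suc n) (λ i → *-congʳ {pow a i n} (P≋Q i))

    compose-horner : ∀ P → compose P a ≋ scale (P 0) 1ₛ +ₛ mul a (compose (tail P) a)
    compose-horner P n = sym (+-congˡ (begin
      mul a (compose (tail P) a) n
        ≈⟨ mul-cong-≤ n (λ _ _ → refl) (λ i i≤n → compose-truncate (tail P) n i i≤n) ⟩
      mul a (Σₛ (suc n) (λ i → scale (P (suc i)) (pow a i))) n
        ≈⟨ mul-Σₛʳ (suc n) a (λ i → scale (P (suc i)) (pow a i)) n ⟩
      Σ (suc n) (λ i → mul a (scale (P (suc i)) (pow a i)) n)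
        ≈⟨ Σ-cong (suc n) (λ i → mul-scaleʳ (P (suc i)) a (pow a i) n) ⟩
      Σ (suc n) (λ i → P (suc i) * pow a (suc i) n)
        ≈⟨ Σ-init-last n _ ⟩
      Σ n (λ i → P (suc i) * pow a (suc i) n) + P (suc n) * pow a (suc n) n
        ≈⟨ +-congˡ (trans (*-congˡ (pow-below-order a a₀≈0 (suc n) n (ℕP.n<1+n n))) (zeroʳ _)) ⟩
      Σ n (λ i → P (suc i) * pow a (suc i) n) + 0#
        ≈⟨ +-identityʳ _ ⟩
      Σ n (λ i → P (suc i) * pow a (suc i) n) ∎))

    compose-distrib-+ : ∀ P Q → compose (P +ₛ Q) a ≋ compose P a +ₛ compose Q a
    compose-distrib-+ P Q n = trans (Σ-cong (suc n) (λ i → distribʳ (pow a i n) (P i) (Q i)))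
                                    (Σ-distrib-+ (suc n) (λ i → P i * pow a i n) (λ i → Q i * pow a i n))

    compose-scale : ∀ x P → compose (scale x P) a ≋ scale x (compose P a)
    compose-scale x P n = trans (Σ-cong (suc n) (λ i → *-assoc x (P i) (pow a i n)))
                                (sym (*-distribˡ-Σ (suc n) x (λ i → P i * pow a i n)))

    compose-1ₛ : compose 1ₛ a ≋ 1ₛ
    compose-1ₛ n = trans (+-cong (*-identityˡ _) (Σ-zero n _ (λ i _ → zeroˡ _))) (+-identityʳ _)

    compose-shift : ∀ R → compose (shift R) a ≋ mul a (compose R a)
    compose-shift R = ≋-trans (compose-horner (shift R)) (λ n → trans (+-congʳ (zeroˡ _)) (+-identityˡ _))

    coeff-compose*mul : ∀ b W V N →
      mul (mul (compose b a) W) V N ≈ Σ (suc N) (λ i → b i * mul (mul (pow a i) W) V N)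
    coeff-compose*mul b W V N = begin
      mul (mul (compose b a) W) V N
        ≈⟨ mul-cong-≤ N (λ i i≤N → mul-cong-≤ i (λ j j≤i → compose-truncate b N j (ℕP.≤-trans j≤i i≤N)) (λ _ _ → refl)) (λ _ _ → refl) ⟩
      mul (mul (Σₛ (suc N) (λ i → scale (b i) (pow a i))) W) V N
        ≈⟨ mul-cong (mul-Σₛˡ (suc N) W (λ i → scale (b i) (pow a i))) ≋-refl N ⟩
      mul (Σₛ (suc N) (λ i → mul (scale (b i) (pow a i)) W)) V N
        ≈⟨ mul-Σₛˡ (suc N) V (λ i → mul (scale (b i) (pow a i)) W) N ⟩
      Σ (suc N) (λ i → mul (mul (scale (b i) (pow a i)) W) V N)
        ≈⟨ Σ-cong (suc N) (λ i → trans (mul-cong (mul-scaleˡ (b i) (pow a i) W) ≋-refl N) (mul-scaleˡ (b i) _ V N)) ⟩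
      Σ (suc N) (λ i → b i * mul (mul (pow a i) W) V N) ∎

    -- By strong induction on the coefficient index: in the Horner step the
    -- recursive product is multiplied by a, which has no constant term.
    compose-mul : ∀ P Q → compose (mul P Q) a ≋ mul (compose P a) (compose Q a)
    compose-mul P Q n = go n n ℕP.≤-refl P
      where
      go : ∀ N m → m ≤ N → ∀ P → compose (mul P Q) a m ≈ mul (compose P a) (compose Q a) m
      go N m m≤N P = begin
        compose (mul P Q) a m
          ≈⟨ compose-congˡ (mul-unfold P Q) m ⟩
        compose (scale (P 0) Q +ₛ shift (mul (tail P) Q)) a m
          ≈⟨ compose-distrib-+ (scale (P 0) Q) (shift (mul (tail P) Q)) m ⟩
        compose (scale (P 0) Q) a m + compose (shift (mul (tail P) Q)) a m
          ≈⟨ +-cong (compose-scale _ Q m) (compose-shift _ m) ⟩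
        P 0 * compose Q a m + mul a (compose (mul (tail P) Q) a) m
          ≈⟨ +-congˡ (mul-cong-< a₀≈0 m (λ i i<m → smaller N i<m m≤N)) ⟩
        P 0 * compose Q a m + mul a (mul (compose (tail P) a) (compose Q a)) m
          ≈⟨ +-cong (sym (trans (mul-scaleˡ _ _ _ m) (*-congˡ (mul-identityˡ _ m)))) (sym (mul-assoc a _ _ m)) ⟩
        mul (scale (P 0) 1ₛ) (compose Q a) m + mul (mul a (compose (tail P) a)) (compose Q a) m
          ≈⟨ sym (mul-distribʳ _ _ _ m) ⟩
        mul (scale (P 0) 1ₛ +ₛ mul a (compose (tail P) a)) (compose Q a) m
          ≈⟨ sym (mul-cong (compose-horner P) ≋-refl m) ⟩
        mul (compose P a) (compose Q a) m ∎
        where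
        smaller : ∀ N {i} → i < m → m ≤ N → compose (mul (tail P) Q) a i ≈ mul (compose (tail P) a) (compose Q a) i
        smaller (suc N) i<m m≤N = go N _ (ℕP.≤-pred (ℕP.≤-trans i<m m≤N)) (tail P)
        smaller zero    i<m m≤N = ⊥-elim (ℕP.n≮0 (ℕP.<-≤-trans i<m m≤N))

  module Lagrange (F G : Series) (F₀≉0 : F 0 ≉ 0#) (G₀≉0 : G 0 ≉ 0#)
                  (G∘xF*F≋1 : mul (compose G (shift F)) F ≋ 1ₛ) where

    xF : Series
    xF = shift F

    open Composition xF refl

    H : Series
    H = compose G xF

    H₀≉0 : H 0 ≉ 0#
    H₀≉0 = ≉0-resp-≈ (sym (trans (+-identityʳ _) (*-identityʳ _))) G₀≉0

    module F^ = Powers F F₀≉0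
    module G^ = Powers G G₀≉0
    module H^ = Powers H H₀≉0

    power-compose : ∀ r → compose (G^.power r) xF ≋ H^.power r
    power-compose = H^.recurrence-unique (λ r → compose (G^.power r) xF) H^.power (λ _ → 0ₛ)
      (≋-trans (compose-congˡ G^.power-zero) (≋-trans compose-1ₛ (≋-sym H^.power-zero)))
      (λ r → ≋-trans (compose-congˡ (G^.power-suc r)) (≋-trans (compose-mul (G^.power r) G) (λ n → sym (+-identityʳ _))))
      (λ r → ≋-trans (H^.power-suc r) (λ n → sym (+-identityʳ _)))

    H^-neg≋F^ : ∀ r → H^.power (ℤ.- r) ≋ F^.power r
    H^-neg≋F^ = F^.recurrence-unique (λ r → H^.power (ℤ.- r)) F^.power (λ _ → 0ₛ)
      (≋-trans H^.power-zero (≋-sym F^.power-zero))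
      (λ r → ≋-trans (≋-sym (mul-identityʳ _)) (≋-trans (mul-cong ≋-refl (≋-sym G∘xF*F≋1)) (≋-trans (≋-sym (mul-assoc _ H F))
        (≋-trans (mul-cong (≋-trans (≋-sym (H^.power-suc (ℤ.- (r ℤ.+ + 1)))) (≡⇒≋ (≡.cong H^.power (lemma r)))) ≋-refl)
                 (λ n → sym (+-identityʳ _))))))
      (λ r → ≋-trans (F^.power-suc r) (λ n → sym (+-identityʳ _)))
      where
      lemma : ∀ r → ℤ.- (r ℤ.+ + 1) ℤ.+ + 1 ≡ ℤ.- r
      lemma = solve-∀

    power-pred*deriv-xF : ∀ r →
      mul (F^.power (r ℤ.- + 1)) (deriv xF) ≋ F^.power r +ₛ shift (mul (F^.power (r ℤ.- + 1)) (deriv F))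
    power-pred*deriv-xF r = ≋-trans (mul-cong ≋-refl (deriv-shift F)) (≋-trans (mul-distribˡ _ F _)
      (+ₛ-cong (≋-trans (≋-sym (F^.power-suc (r ℤ.- + 1))) (≡⇒≋ (≡.cong F^.power (i-1+1≡i r))))
               (mul-shiftʳ _ (deriv F))))

    coeff-power-pred*deriv-xF : ∀ r M →
      fromℤ r * mul (F^.power (r ℤ.- + 1)) (deriv xF) M ≈ fromℤ (r ℤ.+ + M) * F^.power r M
    coeff-power-pred*deriv-xF r zero = trans (*-congˡ (trans (power-pred*deriv-xF r 0) (+-identityʳ _)))
      (*-congʳ (≡⇒≈ (≡.cong fromℤ (≡.sym (ℤP.+-identityʳ r)))))
    coeff-power-pred*deriv-xF r (suc m) = begin
      fromℤ r * mul (F^.power (r ℤ.- + 1)) (deriv xF) (suc m)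
        ≈⟨ *-congˡ (power-pred*deriv-xF r (suc m)) ⟩
      fromℤ r * (F^.power r (suc m) + mul (F^.power (r ℤ.- + 1)) (deriv F) m)
        ≈⟨ distribˡ _ _ _ ⟩
      fromℤ r * F^.power r (suc m) + fromℤ r * mul (F^.power (r ℤ.- + 1)) (deriv F) m
        ≈⟨ +-congˡ (sym (F^.deriv-power r m)) ⟩
      fromℤ r * F^.power r (suc m) + fromℕ (suc m) * F^.power r (suc m)
        ≈⟨ sym (distribʳ _ _ _) ⟩
      (fromℤ r + fromℕ (suc m)) * F^.power r (suc m)
        ≈⟨ *-congʳ (sym (fromℤ-+ r (+ suc m))) ⟩
      fromℤ (r ℤ.+ + suc m) * F^.power r (suc m) ∎

    residue-zero : mul (F^.power -[1+ 0 ]) (deriv xF) 0 ≈ 1#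
    residue-zero = trans (*-congˡ (trans (*-congʳ fromℕ-1) (*-identityˡ _))) (F^.power-inverse 0)

    residue-suc : ∀ m → mul (F^.power -[1+ suc m ]) (deriv xF) (suc m) ≈ 0#
    residue-suc m = *-cancelˡ (fromℤ-≉0 -[1+ m ] (λ ())) (begin
      fromℤ -[1+ m ] * mul (F^.power -[1+ suc m ]) (deriv xF) (suc m)
        ≈⟨ *-congˡ (mul-cong (≡⇒≋ (≡.cong F^.power (≡.sym (-+n-1≡-[1+n] (suc m))))) ≋-refl (suc m)) ⟩
      fromℤ -[1+ m ] * mul (F^.power (-[1+ m ] ℤ.- + 1)) (deriv xF) (suc m)
        ≈⟨ coeff-power-pred*deriv-xF -[1+ m ] (suc m) ⟩
      fromℤ (-[1+ m ] ℤ.+ + suc m) * F^.power -[1+ m ] (suc m)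
        ≈⟨ *-congʳ (≡⇒≈ (≡.cong fromℤ (ℤP.n⊖n≡0 (suc m)))) ⟩
      0# * F^.power -[1+ m ] (suc m)
        ≈⟨ zeroˡ _ ⟩
      0#
        ≈⟨ sym (zeroʳ _) ⟩
      fromℤ -[1+ m ] * 0# ∎)

    coeff-pow-xF*power : ∀ N i → i ≤ N →
      mul (mul (pow xF i) (F^.power -[1+ N ])) (deriv xF) N ≈ mul (F^.power -[1+ N ∸ i ]) (deriv xF) (N ∸ i)
    coeff-pow-xF*power N i i≤N = begin
      mul (mul (pow xF i) W) (deriv xF) N
        ≈⟨ mul-cong (mul-cong (pow-shiftBy 1 F i) ≋-refl) ≋-refl N ⟩
      mul (mul (shiftBy (1 ℕ.* i) (pow F i)) W) (deriv xF) N
        ≡⟨ ≡.cong (λ s → mul (mul (shiftBy s (pow F i)) W) (deriv xF) N) (ℕP.*-identityˡ i) ⟩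
      mul (mul (shiftBy i (pow F i)) W) (deriv xF) N
        ≈⟨ mul-cong (mul-shiftByˡ i _ W) ≋-refl N ⟩
      mul (shiftBy i (mul (pow F i) W)) (deriv xF) N
        ≈⟨ mul-shiftByˡ i _ (deriv xF) N ⟩
      shiftBy i (mul (mul (pow F i) W) (deriv xF)) N
        ≈⟨ shiftBy-above i _ N i≤N ⟩
      mul (mul (pow F i) W) (deriv xF) (N ∸ i)
        ≈⟨ mul-cong (≋-trans (mul-cong (≋-sym (F^.power-+ℕ i)) ≋-refl) (≋-sym (F^.power-homo-+ (+ i) _))) ≋-refl (N ∸ i) ⟩
      mul (F^.power (+ i ℤ.+ -[1+ N ])) (deriv xF) (N ∸ i)
        ≡⟨ ≡.cong (λ r → mul (F^.power r) (deriv xF) (N ∸ i)) exponent≡ ⟩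
      mul (F^.power -[1+ N ∸ i ]) (deriv xF) (N ∸ i) ∎
      where
      W : Series
      W = F^.power -[1+ N ]
      lemma : ∀ i t → i ℤ.+ (ℤ.- (i ℤ.+ t) ℤ.- + 1) ≡ ℤ.- t ℤ.- + 1
      lemma = solve-∀
      exponent≡ : + i ℤ.+ -[1+ N ] ≡ -[1+ N ∸ i ]
      exponent≡ = ≡.trans (≡.cong (λ z → + i ℤ.+ z) (≡.sym (-+n-1≡-[1+n] N)))
        (≡.trans (≡.cong (λ z → + i ℤ.+ (ℤ.- (+ z) ℤ.- + 1)) (≡.sym (ℕP.m+[n∸m]≡n i≤N)))
        (≡.trans (lemma (+ i) (+ (N ∸ i))) (-+n-1≡-[1+n] (N ∸ i))))

    residue-pow-xF : ∀ N (b : Series) i → i < suc N → i ≢ N →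
      b i * mul (F^.power -[1+ N ∸ i ]) (deriv xF) (N ∸ i) ≈ 0#
    residue-pow-xF N b i (s≤s i≤N) i≢N with N ∸ i in N-i≡
    ... | zero  = ⊥-elim (i≢N (ℕP.≤-antisym i≤N (ℕP.m∸n≡0⇒m≤n N-i≡)))
    ... | suc t = trans (*-congˡ (residue-suc t)) (zeroʳ _)

    -- F^{k−1}(xF)′ = F^n F^{−N−1}(xF)′ = (G^{−n} ∘ xF) F^{−N−1}(xF)′ with n = k + N;
    -- expanding the composition, only the i = N term has a nonzero residue.
    expansion : ∀ k N → mul (F^.power (k ℤ.- + 1)) (deriv xF) N ≈ G^.power (ℤ.- (k ℤ.+ + N)) N
    expansion k N = begin
      mul (F^.power (k ℤ.- + 1)) (deriv xF) N
        ≈⟨ mul-cong (≋-trans (≡⇒≋ (≡.cong F^.power (≡.sym exponent≡))) (F^.power-homo-+ n _)) ≋-refl N ⟩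
      mul (mul (F^.power n) W) (deriv xF) N
        ≈⟨ mul-cong (mul-cong (≋-trans (≋-sym (H^-neg≋F^ n)) (≋-sym (power-compose (ℤ.- n)))) ≋-refl) ≋-refl N ⟩
      mul (mul (compose b xF) W) (deriv xF) N
        ≈⟨ coeff-compose*mul b W (deriv xF) N ⟩
      Σ (suc N) (λ i → b i * mul (mul (pow xF i) W) (deriv xF) N)
        ≈⟨ Σ-cong-< (suc N) (λ i i<1+N → *-congˡ {b i} (coeff-pow-xF*power N i (ℕP.≤-pred i<1+N))) ⟩
      Σ (suc N) residueTerm
        ≈⟨ Σ-single (suc N) residueTerm N (ℕP.n<1+n N) (residue-pow-xF N b) ⟩
      residueTerm N
        ≈⟨ *-congˡ (trans (≡⇒≈ (≡.cong (λ t → mul (F^.power -[1+ t ]) (deriv xF) t) (ℕP.n∸n≡0 N))) residue-zero) ⟩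
      b N * 1#
        ≈⟨ *-identityʳ _ ⟩
      b N ∎
      where
      n : ℤ
      n = k ℤ.+ + N
      b W : Series
      b = G^.power (ℤ.- n)
      W = F^.power -[1+ N ]
      residueTerm : ℕ → Carrier
      residueTerm i = b i * mul (F^.power -[1+ N ∸ i ]) (deriv xF) (N ∸ i)
      exponent≡ : n ℤ.+ -[1+ N ] ≡ k ℤ.- + 1
      exponent≡ = ≡.trans (≡.cong (λ z → n ℤ.+ z) (≡.sym (-+n-1≡-[1+n] N))) (lemma k (+ N))
        where
        lemma : ∀ k N → k ℤ.+ N ℤ.+ (ℤ.- N ℤ.- + 1) ≡ k ℤ.- + 1
        lemma = solve-∀

    lagrange : ∀ k N → fromℤ k * G^.power (ℤ.- (k ℤ.+ + N)) N ≈ fromℤ (k ℤ.+ + N) * F^.power k N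
    lagrange k N = begin
      fromℤ k * G^.power (ℤ.- (k ℤ.+ + N)) N             ≈⟨ *-congˡ (sym (expansion k N)) ⟩
      fromℤ k * mul (F^.power (k ℤ.- + 1)) (deriv xF) N  ≈⟨ coeff-power-pred*deriv-xF k N ⟩
      fromℤ (k ℤ.+ + N) * F^.power k N                   ∎

module BellInverse {c ℓ} (K : CharZeroField c ℓ) where

  open LagrangeInversion K public

  δ-diagonal : ∀ m → δ K m m ≈ 1#
  δ-diagonal m rewrite dec-true (m ≟ m) ≡.refl = refl

  δ-off-diagonal : ∀ m i → i ≢ m → δ K m i ≈ 0#
  δ-off-diagonal m i i≢m rewrite dec-false (m ≟ i) (i≢m ∘ ≡.sym) = refl

  module RightInverse (X : ℕ → Carrier) (A : ℕ → ℕ → Carrier) (A-inverse : IsBellInverse K X A) where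

    open IsBellInverse A-inverse

    B-lowerTri : ∀ i j → i < j → B K i j X ≈ 0#
    B-lowerTri i j i<j = trans (BellSeries.B≈coeff-pow X i j)
      (trans (*-congˡ (trans (*-congˡ (pow-below-order (BellSeries.egf X) refl j i i<j)) (zeroʳ _))) (zeroʳ _))

    A*B≈δ : ∀ m j → j ≤ m → Σ (suc m) (λ i → A m i * B K i j X) ≈ δ K m j
    A*B≈δ m j j≤m = begin
      Σ (suc m) f                                  ≡⟨ ≡.cong (λ z → Σ z f) (≡.sym (ℕP.m+[n∸m]≡n (ℕP.m≤n⇒m≤1+n j≤m))) ⟩
      Σ (j ℕ.+ (suc m ∸ j)) f                      ≈⟨ Σ-split j (suc m ∸ j) f ⟩
      Σ j f + Σ (suc m ∸ j) (λ t → f (j ℕ.+ t))    ≈⟨ +-congʳ (Σ-zero j f (λ i i<j → trans (*-congˡ (B-lowerTri i j i<j)) (zeroʳ _))) ⟩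
      0# + Σ (suc m ∸ j) (λ t → f (j ℕ.+ t))       ≈⟨ +-identityˡ _ ⟩
      Σ (suc m ∸ j) (λ t → f (j ℕ.+ t))            ≡⟨ ≡.sym (sumRange≡Σ j (suc m ∸ j) f) ⟩
      sumFromTo j m f                              ≈⟨ inverse m j j≤m ⟩
      δ K m j                                      ∎
      where
      f : ℕ → Carrier
      f i = A m i * B K i j X

    A-diagonal-≉0 : ∀ m → A m m ≉ 0#
    A-diagonal-≉0 m Amm≈0 = 1≉0 (begin
      1#                                   ≈⟨ sym (δ-diagonal m) ⟩
      δ K m m                              ≈⟨ sym (A*B≈δ m m ℕP.≤-refl) ⟩
      Σ (suc m) (λ i → A m i * B K i m X)  ≈⟨ Σ-single (suc m) _ m (ℕP.n<1+n m) off-diagonal ⟩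
      A m m * B K m m X                    ≈⟨ *-congʳ Amm≈0 ⟩
      0# * B K m m X                       ≈⟨ zeroˡ _ ⟩
      0#                                   ∎)
      where
      off-diagonal : ∀ i → i < suc m → i ≢ m → A m i * B K i m X ≈ 0#
      off-diagonal i (s≤s i≤m) i≢m = trans (*-congˡ (B-lowerTri i m (ℕP.≤∧≢⇒< i≤m i≢m))) (zeroʳ _)

    BA : ℕ → ℕ → Carrier
    BA m j = Σ (suc m) (λ i → B K m i X * A i j)

    A*BA≈A : ∀ m j → Σ (suc m) (λ l → A m l * BA l j) ≈ A m j
    A*BA≈A m j = begin
      Σ (suc m) (λ l → A m l * BA l j)                       ≈⟨ Σ-cong-< (suc m) extend ⟩
      Σ (suc m) (λ l → A m l * Σ (suc m) (λ i → BA′ l i))    ≈⟨ Σ-cong (suc m) (λ l → *-distribˡ-Σ (suc m) (A m l) (BA′ l)) ⟩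
      Σ (suc m) (λ l → Σ (suc m) (λ i → A m l * BA′ l i))    ≈⟨ Σ-comm (suc m) (suc m) (λ l i → A m l * BA′ l i) ⟩
      Σ (suc m) (λ i → Σ (suc m) (λ l → A m l * BA′ l i))    ≈⟨ Σ-cong (suc m) reassociate ⟩
      Σ (suc m) (λ i → Σ (suc m) (λ l → A m l * B K l i X) * A i j)
        ≈⟨ Σ-cong-< (suc m) (λ i i<1+m → *-congʳ {A i j} (A*B≈δ m i (ℕP.≤-pred i<1+m))) ⟩
      Σ (suc m) (λ i → δ K m i * A i j)
        ≈⟨ Σ-single (suc m) (λ i → δ K m i * A i j) m (ℕP.n<1+n m) (λ i _ i≢m → trans (*-congʳ (δ-off-diagonal m i i≢m)) (zeroˡ _)) ⟩
      δ K m m * A m j                                        ≈⟨ trans (*-congʳ (δ-diagonal m)) (*-identityˡ _) ⟩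
      A m j                                                  ∎
      where
      BA′ : ℕ → ℕ → Carrier
      BA′ l i = B K l i X * A i j
      extend : ∀ l → l < suc m → A m l * BA l j ≈ A m l * Σ (suc m) (BA′ l)
      extend l (s≤s l≤m) = *-congˡ (sym (Σ-truncate (suc l) (suc m) (BA′ l) (s≤s l≤m)
        (λ i l<i _ → trans (*-congʳ (B-lowerTri l i l<i)) (zeroˡ _))))
      reassociate : ∀ i → Σ (suc m) (λ l → A m l * BA′ l i) ≈ Σ (suc m) (λ l → A m l * B K l i X) * A i j
      reassociate i = trans (Σ-cong (suc m) (λ l → sym (*-assoc (A m l) (B K l i X) (A i j))))
                            (sym (*-distribʳ-Σ (suc m) (A i j) (λ l → A m l * B K l i X)))

    A*δ≈A : ∀ m j → Σ (suc m) (λ l → A m l * δ K l j) ≈ A m j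
    A*δ≈A m j = by-cases (j ≤? m)
      where
      f : ℕ → Carrier
      f l = A m l * δ K l j
      vanish : ∀ l → j ≢ l → f l ≈ 0#
      vanish l j≢l = trans (*-congˡ {A m l} (δ-off-diagonal l j j≢l)) (zeroʳ _)
      by-cases : Dec (j ≤ m) → Σ (suc m) f ≈ A m j
      by-cases (yes j≤m) = trans (Σ-single (suc m) f j (s≤s j≤m) (λ l _ l≢j → vanish l (l≢j ∘ ≡.sym)))
                                 (trans (*-congˡ (δ-diagonal j)) (*-identityʳ _))
      by-cases (no  j≰m) = trans (Σ-zero (suc m) f (λ l l<1+m → vanish l (λ { ≡.refl → j≰m (ℕP.≤-pred l<1+m) })))
                                 (sym (lowerTri m j (ℕP.≰⇒> j≰m)))

    BA-δ : ℕ → ℕ → Carrier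
    BA-δ l j = BA l j + - δ K l j

    A*[BA-δ]≈0 : ∀ m j → Σ (suc m) (λ l → A m l * BA-δ l j) ≈ 0#
    A*[BA-δ]≈0 m j = begin
      Σ (suc m) (λ l → A m l * BA-δ l j)
        ≈⟨ Σ-cong (suc m) (λ l → distribˡ (A m l) (BA l j) (- δ K l j)) ⟩
      Σ (suc m) (λ l → A m l * BA l j + A m l * - δ K l j)
        ≈⟨ Σ-distrib-+ (suc m) (λ l → A m l * BA l j) (λ l → A m l * - δ K l j) ⟩
      Σ (suc m) (λ l → A m l * BA l j) + Σ (suc m) (λ l → A m l * - δ K l j)
        ≈⟨ +-cong (A*BA≈A m j) negated ⟩
      A m j + - A m j
        ≈⟨ -‿inverseʳ _ ⟩
      0#                                                                   ∎
      where
      negated : Σ (suc m) (λ l → A m l * - δ K l j) ≈ - A m j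
      negated = trans (Σ-cong (suc m) (λ l → sym (-‿distribʳ-* (A m l) (δ K l j))))
                (trans (sym (-‿distrib-Σ (suc m) (λ l → A m l * δ K l j))) (-‿cong (A*δ≈A m j)))

    -- A is lower triangular with invertible diagonal, so A·D = 0 forces D = 0,
    -- row by row (strong induction on m).
    BA-δ≈0 : ∀ j m → BA-δ m j ≈ 0#
    BA-δ≈0 j m = go m m ℕP.≤-refl
      where
      go : ∀ M m → m ≤ M → BA-δ m j ≈ 0#
      go M m m≤M = *-cancelˡ (A-diagonal-≉0 m) (begin
        A m m * BA-δ m j                                   ≈⟨ sym (+-identityˡ _) ⟩
        0# + A m m * BA-δ m j                              ≈⟨ +-congʳ (sym earlierRows) ⟩
        Σ m (λ l → A m l * BA-δ l j) + A m m * BA-δ m j    ≈⟨ sym (Σ-init-last m (λ l → A m l * BA-δ l j)) ⟩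
        Σ (suc m) (λ l → A m l * BA-δ l j)                 ≈⟨ A*[BA-δ]≈0 m j ⟩
        0#                                                 ≈⟨ sym (zeroʳ _) ⟩
        A m m * 0#                                         ∎)
        where
        earlier : ∀ M {l} → l < m → m ≤ M → BA-δ l j ≈ 0#
        earlier zero    l<m m≤M = ⊥-elim (ℕP.n≮0 (ℕP.<-≤-trans l<m m≤M))
        earlier (suc M) l<m m≤M = go M _ (ℕP.≤-pred (ℕP.<-≤-trans l<m m≤M))
        earlierRows : Σ m (λ l → A m l * BA-δ l j) ≈ 0#
        earlierRows = Σ-zero m _ (λ l l<m → trans (*-congˡ (earlier M l<m m≤M)) (zeroʳ _))

    B*A≈δ : ∀ m j → BA m j ≈ δ K m j
    B*A≈δ m j = x-y≈0⇒x≈y (BA-δ≈0 j m)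

  -- With F(x) = Σ Yᵢ xⁱ/i! and G(x) = Σ Y′ᵢ xⁱ/i! for the sequences of the
  -- statement, x·F is the exponential generating function of X and x·G is
  -- its compositional inverse g.
  module CompositionalInverse (X : ℕ → Carrier) (A : ℕ → ℕ → Carrier) (A-inverse : IsBellInverse K X A) where

    open RightInverse X A A-inverse
    open IsBellInverse A-inverse using (lowerTri)
    open BellSeries X using (egf; B≈coeff-pow)

    Y Y′ : ℕ → Carrier
    Y  i = X (suc i) * (fromℕ (suc i) ⁻¹)
    Y′ i = A (suc i) 1 * (fromℕ (suc i) ⁻¹)

    F G : Series
    F = expSeries Y
    G = expSeries Y′

    egf≋xF : egf ≋ shift F
    egf≋xF zero          = refl
    egf≋xF (suc zero)    = refl
    egf≋xF (suc (suc s)) = trans (*-congˡ ([1+n]!⁻¹ (suc s))) (sym (*-assoc _ _ _))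

    g : Series
    g i = A i 1 * (fromℕ (i !) ⁻¹)

    g≋xG : g ≋ shift G
    g≋xG zero          = trans (*-congʳ (lowerTri 0 1 (s≤s z≤n))) (zeroˡ _)
    g≋xG (suc zero)    = refl
    g≋xG (suc (suc s)) = trans (*-congˡ ([1+n]!⁻¹ (suc s))) (sym (*-assoc _ _ _))

    -- Coefficientwise, g ∘ egf = x is the identity B·A = I in its first column.
    g∘egf≈x : ∀ m → compose g egf m ≈ shift 1ₛ m
    g∘egf≈x m = *-cancelˡ (n!≉0 m) (begin
      fromℕ (m !) * compose g egf m                       ≈⟨ *-distribˡ-Σ (suc m) (fromℕ (m !)) (λ i → g i * pow egf i m) ⟩
      Σ (suc m) (λ i → fromℕ (m !) * (g i * pow egf i m)) ≈⟨ Σ-cong (suc m) entry ⟩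
      BA m 1                                              ≈⟨ B*A≈δ m 1 ⟩
      δ K m 1                                             ≈⟨ δ-first-column m ⟩
      fromℕ (m !) * shift 1ₛ m                            ∎)
      where
      entry : ∀ i → fromℕ (m !) * (g i * pow egf i m) ≈ B K m i X * A i 1
      entry i = sym (trans (*-congʳ (B≈coeff-pow m i))
        (*-Solver.solve 4 (λ x y z w → (x ⊕ (y ⊕ z)) ⊕ w ⊜ x ⊕ ((w ⊕ y) ⊕ z)) refl _ _ _ _))
        where open *-Solver
      δ-first-column : ∀ m → δ K m 1 ≈ fromℕ (m !) * shift 1ₛ m
      δ-first-column zero          = sym (zeroʳ _)
      δ-first-column (suc zero)    = sym (trans (*-identityʳ _) fromℕ-1)
      δ-first-column (suc (suc m)) = sym (zeroʳ _)

    G∘xF*F≋1 : mul (compose G (shift F)) F ≋ 1ₛ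
    G∘xF*F≋1 = ≋-trans (mul-comm _ F) (λ n → begin
      mul F (compose G (shift F)) n                 ≈⟨ sym (mul-shiftˡ F (compose G (shift F)) (suc n)) ⟩
      mul (shift F) (compose G (shift F)) (suc n)   ≈⟨ sym (compose-shift G (suc n)) ⟩
      compose (shift G) (shift F) (suc n)           ≈⟨ Σ-cong (suc (suc n)) (λ i → sym (*-cong (g≋xG i) (pow-cong i egf≋xF (suc n)))) ⟩
      compose g egf (suc n)                         ≈⟨ g∘egf≈x (suc n) ⟩
      1ₛ n                                          ∎)
      where open Composition (shift F) refl

proposition8p5 : ∀ {c ℓ} (K : CharZeroField c ℓ) →
    let open CharZeroField K in
    (X : ℕ → Carrier) → ¬ (X 1 ≈ 0#) →
    (A : ℕ → ℕ → Carrier) → IsBellInverse K X A →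
    (n k : ℤ) → k ℤ.≤ n → n ≢ 0ℤ →
    Phat K (ℤ.∣ n ℤ.- k ∣) k (λ i → X (suc i) * (fromℕ (suc i) ⁻¹))
    ≈ (fromℤ k * (fromℤ n ⁻¹))
    * Phat K (ℤ.∣ n ℤ.- k ∣) (ℤ.- n) (λ i → A (suc i) 1 * (fromℕ (suc i) ⁻¹))
proposition8p5 K X X₁≉0 A A-inverse n k k≤n n≢0 = begin
  Phat K N k Y
    ≈⟨ Phat≈coeff-power Y F₀≉0 N k ⟩
  fromℕ (N !) * F^.power k N
    ≈⟨ *-congˡ (sym lagrange′) ⟩
  fromℕ (N !) * ((fromℤ n ⁻¹) * (fromℤ k * G^.power (ℤ.- n) N))
    ≈⟨ *-Solver.solve 4 (λ x y z w → x ⊕ (y ⊕ (z ⊕ w)) ⊜ (z ⊕ y) ⊕ (x ⊕ w)) refl _ _ _ _ ⟩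
  (fromℤ k * (fromℤ n ⁻¹)) * (fromℕ (N !) * G^.power (ℤ.- n) N)
    ≈⟨ *-congˡ (sym (Phat≈coeff-power Y′ G₀≉0 N (ℤ.- n))) ⟩
  (fromℤ k * (fromℤ n ⁻¹)) * Phat K N (ℤ.- n) Y′ ∎
  where
  open BellInverse K
  open *-Solver using (_⊕_; _⊜_)
  open RightInverse X A A-inverse using (A-diagonal-≉0)
  open CompositionalInverse X A A-inverse
  F₀≉0 : F 0 ≉ 0#
  F₀≉0 = *-≉0 X₁≉0 (⁻¹-≉0 (charZero 0))
  G₀≉0 : G 0 ≉ 0#
  G₀≉0 = *-≉0 (A-diagonal-≉0 1) (⁻¹-≉0 (charZero 0))
  open Lagrange F G F₀≉0 G₀≉0 G∘xF*F≋1
  N : ℕ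
  N = ℤ.∣ n ℤ.- k ∣

  n≡k+N : n ≡ k ℤ.+ + N
  n≡k+N = ≡.trans (n≡k+[n-k] n k) (≡.cong (λ z → k ℤ.+ z) (≡.sym (ℤP.0≤i⇒+∣i∣≡i (ℤP.i≤j⇒0≤j-i k≤n))))
    where
    n≡k+[n-k] : ∀ n k → n ≡ k ℤ.+ (n ℤ.- k)
    n≡k+[n-k] = solve-∀

  lagrange′ : (fromℤ n ⁻¹) * (fromℤ k * G^.power (ℤ.- n) N) ≈ F^.power k N
  lagrange′ = begin
    (fromℤ n ⁻¹) * (fromℤ k * G^.power (ℤ.- n) N)
      ≡⟨ ≡.cong (λ z → (fromℤ n ⁻¹) * (fromℤ k * G^.power (ℤ.- z) N)) n≡k+N ⟩
    (fromℤ n ⁻¹) * (fromℤ k * G^.power (ℤ.- (k ℤ.+ + N)) N)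
      ≈⟨ *-congˡ (lagrange k N) ⟩
    (fromℤ n ⁻¹) * (fromℤ (k ℤ.+ + N) * F^.power k N)
      ≡⟨ ≡.cong (λ z → (fromℤ n ⁻¹) * (fromℤ z * F^.power k N)) (≡.sym n≡k+N) ⟩
    (fromℤ n ⁻¹) * (fromℤ n * F^.power k N)
      ≈⟨ sym (*-assoc _ _ _) ⟩
    ((fromℤ n ⁻¹) * fromℤ n) * F^.power k N
      ≈⟨ *-congʳ (inverseˡ _ (fromℤ-≉0 n n≢0)) ⟩
    1# * F^.power k N
      ≈⟨ *-identityˡ _ ⟩
    F^.power k N ∎
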